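{- For $s'\in\{\mathrm{se},\mathrm{nw},\mathrm{sw},\mathrm{ne}\}$, the linear map $\phi_{s'}:\mathbf{ASM}\to\mathbb K(q)$ defined, for every alternating sign matrix $\delta$ of size $n$, by $\phi_{s'}(\mathbf F_{M^\delta})=\frac{q^{s'(\delta)}}{[n]_q!}$ is an algebra morphism.
   Context: $\mathbb K$ is a field of characteristic zero; $[n]_q=1+q+\dots+q^{n-1}$, $[0]_q!=1$, $[n]_q!=[1]_q\cdots[n]_q$. An alternating sign matrix (ASM) of size $n$ is an $n\times n$ matrix with entries in $\{0,1,-1\}$ such that in every row and every column the nonzero entries alternate in sign, the first and last nonzero entries being $1$. For an entry $(i,j)$ let $a_{ij}=\sum_{k<j}\delta_{ik}$ and $b_{ij}=\sum_{k<i}\delta_{kj}$ (both in $\{0,1\}$); $\mathrm{ne}(\delta),\mathrm{sw}(\delta),\mathrm{se}(\delta),\mathrm{nw}(\delta)$ are the numbers of entries with $\delta_{ij}=0$ and, respectively, $(a_{ij},b_{ij})=(0,0),(1,1),(0,1),(1,0)$ (the four zero-vertex types of the associated six-vertex configuration). $M^\delta$ is the $0/1$ matrix with $M^\delta_{ij}=1$ iff $\delta_{ij}\neq0$. $\mathbf{ASM}$ is the vector space with basis $\{\mathbf F_{M^\delta}\}$, $\delta$ ranging over ASMs, with product: for $M_1=M^{\delta_1}$, $M_2=M^{\delta_2}$ of sizes $n_1,n_2$, $\mathbf F_{M_1}\cdot\mathbf F_{M_2}=\sum\mathbf F_M$ over all matrices $M$ whose sequence of columns is a shuffle of the columns of $\begin{bmatrix}M_1\\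 0_{n_2\times n_1}\end{bmatrix}$ with those of $\begin{bmatrix}0_{n_1\times n_2}\\ M_2\end{bmatrix}$. -}

module Defs where

open import Data.Nat as ℕ using (ℕ; zero; suc)
import Data.Nat.Properties as ℕP
open import Data.Integer as ℤ using (ℤ; +_; -[1+_])
open import Data.Fin as Fin using (Fin; zero; suc; toℕ; splitAt; cast)
open import Data.Sum using (_⊎_; inj₁; inj₂)
import Data.Sum as Sum
open import Data.Bool using (Bool; true; false; _∧_; not)
open import Data.List as List using (List; []; _∷_; [_]; _++_; map; foldr; filter; take; replicate; allFin; length; concatMap)
open import Data.Product using (_×_; _,_)
open import Relation.Nullary using (¬?)
open import Relation.Nullary.Decidable using (⌊_⌋)
open import Relation.Binary.PropositionalEquality using (_≡_; sym)
open import Function using (_∘_)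

Mat : ℕ → Set
Mat n = Fin n → Fin n → ℤ

row : ∀ {n} → Mat n → Fin n → List ℤ
row {n} δ i = map (δ i) (allFin n)

col : ∀ {n} → Mat n → Fin n → List ℤ
col {n} δ j = map (λ i → δ i j) (allFin n)

nonzeros : List ℤ → List ℤ
nonzeros = filter (λ x → ¬? (x ℤ.≟ + 0))

data Alternating : List ℤ → Set where
  single : Alternating [ + 1 ]
  step   : ∀ {l} → Alternating l → Alternating (+ 1 ∷ -[1+ 0 ] ∷ l)

record IsASM {n : ℕ} (δ : Mat n) : Set where
  field
    entries : ∀ i j → (δ i j ≡ + 0) ⊎ (δ i j ≡ + 1) ⊎ (δ i j ≡ -[1+ 0 ])
    rows    : ∀ i → Alternating (nonzeros (row δ i))
    cols    : ∀ j → Alternating (nonzeros (col δ j))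

support : ∀ {n} → Mat n → Fin n → Fin n → Bool
support δ i j = not ⌊ δ i j ℤ.≟ + 0 ⌋

aStat : ∀ {n} → Mat n → Fin n → Fin n → ℤ
aStat δ i j = List.foldr ℤ._+_ (+ 0) (take (toℕ j) (row δ i))

bStat : ∀ {n} → Mat n → Fin n → Fin n → ℤ
bStat δ i j = List.foldr ℤ._+_ (+ 0) (take (toℕ i) (col δ j))

data Stat : Set where
  se nw sw ne : Stat

pattern′ : Stat → ℤ × ℤ
pattern′ ne = + 0 , + 0
pattern′ sw = + 1 , + 1
pattern′ se = + 0 , + 1
pattern′ nw = + 1 , + 0

isOfType : ∀ {n} → Stat → Mat n → Fin n → Fin n → Bool
isOfType s δ i j with pattern′ s
... | (a , b) = ⌊ δ i j ℤ.≟ + 0 ⌋ ∧ ⌊ aStat δ i j ℤ.≟ a ⌋ ∧ ⌊ bStat δ i j ℤ.≟ b ⌋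

countBool : List Bool → ℕ
countBool [] = 0
countBool (true ∷ bs) = suc (countBool bs)
countBool (false ∷ bs) = countBool bs

stat : ∀ {n} → Stat → Mat n → ℕ
stat {n} s δ = countBool (concatMap (λ i → map (isOfType s δ i) (allFin n)) (allFin n))

-- a shuffle of a sequence of m columns with a sequence of n columns
data Shuffle : ℕ → ℕ → Set where
  done : Shuffle 0 0
  takeL : ∀ {m n} → Shuffle m n → Shuffle (suc m) n
  takeR : ∀ {m n} → Shuffle m n → Shuffle m (suc n)

allShuffles : (m n : ℕ) → List (Shuffle m n)
allShuffles zero zero = [ done ]
allShuffles (suc m) zero = map takeL (allShuffles m zero)
allShuffles zero (suc n) = map takeR (allShuffles zero n)
allShuffles (suc m) (suc n) = map takeL (allShuffles m (suc n)) ++ map takeR (allShuffles (suc m) n)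

colSource : ∀ {m n} → Shuffle m n → Fin (m ℕ.+ n) → Fin m ⊎ Fin n
colSource done ()
colSource (takeL s) zero = inj₁ zero
colSource (takeL s) (suc k) = Sum.map suc (λ x → x) (colSource s k)
colSource {m} {suc n} (takeR s) c with cast (ℕP.+-suc m n) c
... | zero = inj₂ zero
... | suc k = Sum.map (λ x → x) suc (colSource s k)

-- the matrix whose sequence of columns is the shuffle s of the columns of
-- [δ₁ ; 0] with those of [0 ; δ₂]
shuffleMat : ∀ {m n} → Shuffle m n → Mat m → Mat n → Mat (m ℕ.+ n)
shuffleMat {m} s δ₁ δ₂ r c with splitAt m r | colSource s c
... | inj₁ i | inj₁ j = δ₁ i j
... | inj₂ i | inj₂ j = δ₂ i j
... | inj₁ _ | inj₂ _ = + 0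
... | inj₂ _ | inj₁ _ = + 0

-- Polynomials in q with natural coefficients (coefficient lists)

Poly : Set
Poly = List ℕ

coeff : Poly → ℕ → ℕ
coeff [] _ = 0
coeff (a ∷ p) zero = a
coeff (a ∷ p) (suc k) = coeff p k

_⊕_ : Poly → Poly → Poly
[] ⊕ q = q
(a ∷ p) ⊕ [] = a ∷ p
(a ∷ p) ⊕ (b ∷ q) = (a ℕ.+ b) ∷ (p ⊕ q)

scale : ℕ → Poly → Poly
scale c = map (c ℕ.*_)

_⊗_ : Poly → Poly → Poly
[] ⊗ q = []
(a ∷ p) ⊗ q = scale a q ⊕ (0 ∷ (p ⊗ q))

_≈ₚ_ : Poly → Poly → Set
p ≈ₚ q = ∀ k → coeff p k ≡ coeff q k

qPow : ℕ → Poly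
qPow k = replicate k 0 ++ [ 1 ]

qInt : ℕ → Poly
qInt n = replicate n 1

qFact : ℕ → Poly
qFact zero = [ 1 ]
qFact (suc n) = qFact n ⊗ qInt (suc n)

-- Rational functions as fractions num/den of polynomials (elements of
-- ℚ(q) ⊆ 𝕂(q)); equality by cross-multiplication.

record RatFun : Set where
  constructor _/_
  field
    num den : Poly

open RatFun public

_≃_ : RatFun → RatFun → Set
(a / b) ≃ (c / d) = (a ⊗ d) ≈ₚ (c ⊗ b)

_+ᵣ_ : RatFun → RatFun → RatFun
(a / b) +ᵣ (c / d) = ((a ⊗ d) ⊕ (c ⊗ b)) / (b ⊗ d)

_*ᵣ_ : RatFun → RatFun → RatFun
(a / b) *ᵣ (c / d) = (a ⊗ c) / (b ⊗ d)

0ᵣ 1ᵣ : RatFun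
0ᵣ = [] / [ 1 ]
1ᵣ = [ 1 ] / [ 1 ]

sumᵣ : List RatFun → RatFun
sumᵣ = foldr _+ᵣ_ 0ᵣ

φ : Stat → ∀ {n} → Mat n → RatFun
φ s {n} δ = qPow (stat s δ) / qFact n

-- φ applied to the product F_{M^δ₁} · F_{M^δ₂}, extended linearly
φProd : Stat → ∀ {m n} → Mat m → Mat n → RatFun
φProd s {m} {n} δ₁ δ₂ = sumᵣ (map (λ σ → φ s (shuffleMat σ δ₁ δ₂)) (allShuffles m n))

-- the empty matrix (unit of ASM)
emptyMat : Mat 0
emptyMat ()

-- Read the columns of a shuffle M of δ₁ and δ₂ from left to right, keeping the partial row sums
-- (the a-values). Every zero inside the copies of δ₁ and δ₂ keeps its a- and b-value, so these
-- zeros contribute s'(δ₁) + s'(δ₂). In the two zero blocks, b is 1 below a column of δ₁ and 0 above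
-- a column of δ₂, while the a-values are 0 or 1, with as many 1s as columns of the other matrix
-- already passed; so the remaining zeros of type s' count the pairs (column of δ₁, column of δ₂)
-- in one of the two relative orders. The sum over all shuffles of q to the power of that count
-- satisfies the q-Pascal recurrence, hence equals [m+n]!/([m]![n]!), and the morphism property
-- follows by bringing the sum of fractions to a common denominator.

module Submission where

open import Defs
open import Algebra.Bundles using (CommutativeSemiring)
open import Algebra.Structures.Biased using (IsCommutativeSemiringˡ)
import Algebra.Properties.CommutativeSemigroup as CommutativeSemigroupProperties
import Algebra.Solver.Ring.NaturalCoefficients.Default as NaturalCoefficientsSolver
open import Data.Bool using (Bool; true; false; _∧_)
open import Data.Empty using (⊥-elim)
open import Data.Fin using (Fin; zero; suc; toℕ; splitAt; cast; _↑ˡ_; _↑ʳ_)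
import Data.Fin.Properties as Finₚ
open import Data.Integer as ℤ using (ℤ; +_; -[1+_])
import Data.Integer.Properties as ℤₚ
open import Data.List using (List; []; _∷_; [_]; map; _++_; foldr; length; take; tabulate; allFin; concat)
import Data.List.Properties as Listₚ
open import Data.Nat as ℕ using (ℕ; zero; suc)
import Data.Nat.Properties as ℕₚ
open import Algebra.Properties.CommutativeMonoid.Sum ℕₚ.+-0-commutativeMonoid
  using (sum; ∑-comm; sum-cong-≗; sum-replicate-zero)
open import Data.Nat.Tactic.RingSolver using (solve-∀)
open import Data.Product using (_×_; _,_; proj₁; proj₂; ∃)
open import Data.Sum using (_⊎_; inj₁; inj₂; [_,_]′)
import Data.Sum as Sum
open import Function using (_∘_; id)
open import Relation.Binary.PropositionalEquality hiding ([_])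
open import Relation.Binary.Structures using (IsEquivalence)
import Relation.Binary.Reasoning.Setoid
open import Relation.Nullary.Decidable using (⌊_⌋; yes; no)

module ℕ+ = CommutativeSemigroupProperties ℕₚ.+-commutativeSemigroup
module ℤ+ = CommutativeSemigroupProperties ℤₚ.+-commutativeSemigroup

infix 4 _≋_

-- `_≈ₚ_` wrapped in a record, so that both polynomials can be inferred from a proof.
record _≋_ (p q : Poly) : Set where
  constructor ⟨_⟩
  field coeff-≡ : p ≈ₚ q
open _≋_

≋-refl : ∀ {p} → p ≋ p
≋-refl = ⟨ (λ _ → refl) ⟩

≋-sym : ∀ {p q} → p ≋ q → q ≋ p
≋-sym ⟨ e ⟩ = ⟨ (λ k → sym (e k)) ⟩

≋-trans : ∀ {p q r} → p ≋ q → q ≋ r → p ≋ r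
≋-trans ⟨ e ⟩ ⟨ f ⟩ = ⟨ (λ k → trans (e k) (f k)) ⟩

≋-isEquivalence : IsEquivalence _≋_
≋-isEquivalence = record { refl = ≋-refl ; sym = ≋-sym ; trans = ≋-trans }

≡⇒≋ : ∀ {p q} → p ≡ q → p ≋ q
≡⇒≋ refl = ≋-refl

coeff-⊕ : ∀ p q k → coeff (p ⊕ q) k ≡ coeff p k ℕ.+ coeff q k
coeff-⊕ []      q       k       = refl
coeff-⊕ (a ∷ p) []      k       = sym (ℕₚ.+-identityʳ _)
coeff-⊕ (a ∷ p) (b ∷ q) zero    = refl
coeff-⊕ (a ∷ p) (b ∷ q) (suc k) = coeff-⊕ p q k

coeff-scale : ∀ c p k → coeff (scale c p) k ≡ c ℕ.* coeff p k
coeff-scale c []      k       = sym (ℕₚ.*-zeroʳ c)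
coeff-scale c (a ∷ p) zero    = refl
coeff-scale c (a ∷ p) (suc k) = coeff-scale c p k

∷-cong : ∀ {a b p q} → a ≡ b → p ≋ q → (a ∷ p) ≋ (b ∷ q)
∷-cong {a} {b} {p} {q} a≡b ⟨ p≈q ⟩ = ⟨ coeffs ⟩
  where
  coeffs : (a ∷ p) ≈ₚ (b ∷ q)
  coeffs zero    = a≡b
  coeffs (suc k) = p≈q k

⊕-cong : ∀ {p p′ q q′} → p ≋ p′ → q ≋ q′ → (p ⊕ q) ≋ (p′ ⊕ q′)
⊕-cong {p} {p′} {q} {q′} ⟨ e ⟩ ⟨ f ⟩ = ⟨ (λ k → begin
  coeff (p ⊕ q) k          ≡⟨ coeff-⊕ p q k ⟩
  coeff p k ℕ.+ coeff q k   ≡⟨ cong₂ ℕ._+_ (e k) (f k) ⟩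
  coeff p′ k ℕ.+ coeff q′ k ≡⟨ coeff-⊕ p′ q′ k ⟨
  coeff (p′ ⊕ q′) k        ∎) ⟩
  where open ≡-Reasoning

⊕-comm : ∀ p q → (p ⊕ q) ≋ (q ⊕ p)
⊕-comm p q = ⟨ (λ k → begin
  coeff (p ⊕ q) k         ≡⟨ coeff-⊕ p q k ⟩
  coeff p k ℕ.+ coeff q k ≡⟨ ℕₚ.+-comm (coeff p k) _ ⟩
  coeff q k ℕ.+ coeff p k ≡⟨ coeff-⊕ q p k ⟨
  coeff (q ⊕ p) k         ∎) ⟩
  where open ≡-Reasoning

⊕-assoc : ∀ p q r → ((p ⊕ q) ⊕ r) ≋ (p ⊕ (q ⊕ r))
⊕-assoc p q r = ⟨ (λ k → begin
  coeff ((p ⊕ q) ⊕ r) k                     ≡⟨ coeff-⊕ (p ⊕ q) r k ⟩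
  coeff (p ⊕ q) k ℕ.+ coeff r k             ≡⟨ cong (ℕ._+ coeff r k) (coeff-⊕ p q k) ⟩
  (coeff p k ℕ.+ coeff q k) ℕ.+ coeff r k   ≡⟨ ℕₚ.+-assoc (coeff p k) _ _ ⟩
  coeff p k ℕ.+ (coeff q k ℕ.+ coeff r k)   ≡⟨ cong (coeff p k ℕ.+_) (coeff-⊕ q r k) ⟨
  coeff p k ℕ.+ coeff (q ⊕ r) k             ≡⟨ coeff-⊕ p (q ⊕ r) k ⟨
  coeff (p ⊕ (q ⊕ r)) k                     ∎) ⟩
  where open ≡-Reasoning

⊕-identityʳ : ∀ p → (p ⊕ []) ≋ p
⊕-identityʳ p = ⟨ (λ k → trans (coeff-⊕ p [] k) (ℕₚ.+-identityʳ _)) ⟩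

⊕-interchange : ∀ w x y z → ((w ⊕ x) ⊕ (y ⊕ z)) ≋ ((w ⊕ y) ⊕ (x ⊕ z))
⊕-interchange w x y z = ⟨ (λ k → begin
  coeff ((w ⊕ x) ⊕ (y ⊕ z)) k
    ≡⟨ trans (coeff-⊕ (w ⊕ x) (y ⊕ z) k) (cong₂ ℕ._+_ (coeff-⊕ w x k) (coeff-⊕ y z k)) ⟩
  (coeff w k ℕ.+ coeff x k) ℕ.+ (coeff y k ℕ.+ coeff z k)
    ≡⟨ ℕ+.interchange (coeff w k) (coeff x k) (coeff y k) (coeff z k) ⟩
  (coeff w k ℕ.+ coeff y k) ℕ.+ (coeff x k ℕ.+ coeff z k)
    ≡⟨ trans (coeff-⊕ (w ⊕ y) (x ⊕ z) k) (cong₂ ℕ._+_ (coeff-⊕ w y k) (coeff-⊕ x z k)) ⟨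
  coeff ((w ⊕ y) ⊕ (x ⊕ z)) k ∎) ⟩
  where open ≡-Reasoning

⊕-swap : ∀ x y z → (x ⊕ (y ⊕ z)) ≋ (y ⊕ (x ⊕ z))
⊕-swap x y z =
  ≋-trans (≋-sym (⊕-assoc x y z)) (≋-trans (⊕-cong (⊕-comm x y) ≋-refl) (⊕-assoc y x z))

[0]≋[] : [ 0 ] ≋ []
[0]≋[] = ⟨ (λ { zero → refl ; (suc k) → refl }) ⟩

scale-cong : ∀ c {p q} → p ≋ q → scale c p ≋ scale c q
scale-cong c {p} {q} ⟨ e ⟩ =
  ⟨ (λ k → trans (coeff-scale c p k) (trans (cong (c ℕ.*_) (e k)) (sym (coeff-scale c q k)))) ⟩

scale-zero : ∀ p → scale 0 p ≋ []
scale-zero p = ⟨ coeff-scale 0 p ⟩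

scale-one : ∀ p → scale 1 p ≋ p
scale-one p = ⟨ (λ k → trans (coeff-scale 1 p k) (ℕₚ.*-identityˡ _)) ⟩

scale-scale : ∀ c a p → scale (c ℕ.* a) p ≋ scale c (scale a p)
scale-scale c a p = ⟨ (λ k → begin
  coeff (scale (c ℕ.* a) p) k   ≡⟨ coeff-scale (c ℕ.* a) p k ⟩
  c ℕ.* a ℕ.* coeff p k         ≡⟨ ℕₚ.*-assoc c a _ ⟩
  c ℕ.* (a ℕ.* coeff p k)       ≡⟨ cong (c ℕ.*_) (coeff-scale a p k) ⟨
  c ℕ.* coeff (scale a p) k     ≡⟨ coeff-scale c (scale a p) k ⟨
  coeff (scale c (scale a p)) k ∎) ⟩
  where open ≡-Reasoning

scale-⊕ : ∀ c p q → scale c (p ⊕ q) ≋ (scale c p ⊕ scale c q)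
scale-⊕ c p q = ⟨ (λ k → begin
  coeff (scale c (p ⊕ q)) k                         ≡⟨ coeff-scale c (p ⊕ q) k ⟩
  c ℕ.* coeff (p ⊕ q) k                             ≡⟨ cong (c ℕ.*_) (coeff-⊕ p q k) ⟩
  c ℕ.* (coeff p k ℕ.+ coeff q k)                   ≡⟨ ℕₚ.*-distribˡ-+ c (coeff p k) _ ⟩
  c ℕ.* coeff p k ℕ.+ c ℕ.* coeff q k               ≡⟨ cong₂ ℕ._+_ (coeff-scale c p k) (coeff-scale c q k) ⟨
  coeff (scale c p) k ℕ.+ coeff (scale c q) k       ≡⟨ coeff-⊕ (scale c p) (scale c q) k ⟨
  coeff (scale c p ⊕ scale c q) k                   ∎) ⟩
  where open ≡-Reasoning

scale-distribʳ : ∀ a b p → scale (a ℕ.+ b) p ≋ (scale a p ⊕ scale b p)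
scale-distribʳ a b p = ⟨ (λ k → begin
  coeff (scale (a ℕ.+ b) p) k                   ≡⟨ coeff-scale (a ℕ.+ b) p k ⟩
  (a ℕ.+ b) ℕ.* coeff p k                       ≡⟨ ℕₚ.*-distribʳ-+ (coeff p k) a b ⟩
  a ℕ.* coeff p k ℕ.+ b ℕ.* coeff p k           ≡⟨ cong₂ ℕ._+_ (coeff-scale a p k) (coeff-scale b p k) ⟨
  coeff (scale a p) k ℕ.+ coeff (scale b p) k   ≡⟨ coeff-⊕ (scale a p) (scale b p) k ⟨
  coeff (scale a p ⊕ scale b p) k               ∎) ⟩
  where open ≡-Reasoning

⊗-congʳ : ∀ p {q q′} → q ≋ q′ → (p ⊗ q) ≋ (p ⊗ q′)
⊗-congʳ []      q≋q′ = ≋-refl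
⊗-congʳ (a ∷ p) q≋q′ = ⊕-cong (scale-cong a q≋q′) (∷-cong refl (⊗-congʳ p q≋q′))

⊗-zeroʳ : ∀ p → (p ⊗ []) ≋ []
⊗-zeroʳ []      = ≋-refl
⊗-zeroʳ (a ∷ p) = ≋-trans (∷-cong refl (⊗-zeroʳ p)) [0]≋[]

⊗-consʳ : ∀ p a q → (p ⊗ (a ∷ q)) ≋ (scale a p ⊕ (0 ∷ (p ⊗ q)))
⊗-consʳ []      a q = ≋-sym [0]≋[]
⊗-consʳ (b ∷ p) a q = ∷-cong (cong (ℕ._+ 0) (ℕₚ.*-comm b a))
  (≋-trans (⊕-cong (≋-refl {scale b q}) (⊗-consʳ p a q)) (⊕-swap (scale b q) (scale a p) _))

⊗-comm : ∀ p q → (p ⊗ q) ≋ (q ⊗ p)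
⊗-comm []      q = ≋-sym (⊗-zeroʳ q)
⊗-comm (a ∷ p) q =
  ≋-trans (⊕-cong (≋-refl {scale a q}) (∷-cong refl (⊗-comm p q))) (≋-sym (⊗-consʳ q a p))

⊗-congˡ : ∀ {p p′} q → p ≋ p′ → (p ⊗ q) ≋ (p′ ⊗ q)
⊗-congˡ {p} {p′} q p≋p′ = ≋-trans (⊗-comm p q) (≋-trans (⊗-congʳ q p≋p′) (⊗-comm q p′))

⊗-cong : ∀ {p p′ q q′} → p ≋ p′ → q ≋ q′ → (p ⊗ q) ≋ (p′ ⊗ q′)
⊗-cong {p′ = p′} {q = q} p≋p′ q≋q′ = ≋-trans (⊗-congˡ q p≋p′) (⊗-congʳ p′ q≋q′)

⊗-distribʳ : ∀ p p′ q → ((p ⊕ p′) ⊗ q) ≋ ((p ⊗ q) ⊕ (p′ ⊗ q))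
⊗-distribʳ []      p′       q = ≋-refl
⊗-distribʳ (a ∷ p) []       q = ≋-sym (⊕-identityʳ _)
⊗-distribʳ (a ∷ p) (b ∷ p′) q =
  ≋-trans (⊕-cong (scale-distribʳ a b q) (∷-cong refl (⊗-distribʳ p p′ q)))
          (⊕-interchange (scale a q) (scale b q) (0 ∷ (p ⊗ q)) (0 ∷ (p′ ⊗ q)))

scale-⊗ : ∀ c p q → (scale c p ⊗ q) ≋ scale c (p ⊗ q)
scale-⊗ c []      q = ≋-refl
scale-⊗ c (a ∷ p) q =
  ≋-trans (⊕-cong (scale-scale c a q) (∷-cong (sym (ℕₚ.*-zeroʳ c)) (scale-⊗ c p q)))
          (≋-sym (scale-⊕ c (scale a q) (0 ∷ (p ⊗ q))))

⊗-shiftˡ : ∀ p q → ((0 ∷ p) ⊗ q) ≋ (0 ∷ (p ⊗ q))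
⊗-shiftˡ p q = ⊕-cong (scale-zero q) ≋-refl

⊗-assoc : ∀ p q r → ((p ⊗ q) ⊗ r) ≋ (p ⊗ (q ⊗ r))
⊗-assoc []      q r = ≋-refl
⊗-assoc (a ∷ p) q r =
  ≋-trans (⊗-distribʳ (scale a q) (0 ∷ (p ⊗ q)) r)
          (⊕-cong (scale-⊗ a q r) (≋-trans (⊗-shiftˡ (p ⊗ q) r) (∷-cong refl (⊗-assoc p q r))))

⊗-identityˡ : ∀ p → ([ 1 ] ⊗ p) ≋ p
⊗-identityˡ p = ≋-trans (⊕-cong (scale-one p) [0]≋[]) (⊕-identityʳ p)

⊗-identityʳ : ∀ p → (p ⊗ [ 1 ]) ≋ p
⊗-identityʳ p = ≋-trans (⊗-comm p [ 1 ]) (⊗-identityˡ p)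

polySemiring : CommutativeSemiring _ _
polySemiring = record
  { Carrier = Poly ; _≈_ = _≋_ ; _+_ = _⊕_ ; _*_ = _⊗_ ; 0# = [] ; 1# = [ 1 ]
  ; isCommutativeSemiring = IsCommutativeSemiringˡ.isCommutativeSemiring (record
    { +-isCommutativeMonoid = record
      { isMonoid = record
        { isSemigroup = record
          { isMagma = record { isEquivalence = ≋-isEquivalence ; ∙-cong = ⊕-cong }
          ; assoc = ⊕-assoc }
        ; identity = (λ _ → ≋-refl) , ⊕-identityʳ }
      ; comm = ⊕-comm }
    ; *-isCommutativeMonoid = record
      { isMonoid = record
        { isSemigroup = record
          { isMagma = record { isEquivalence = ≋-isEquivalence ; ∙-cong = ⊗-cong }
          ; assoc = ⊗-assoc }
        ; identity = ⊗-identityˡ , ⊗-identityʳ }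
      ; comm = ⊗-comm }
    ; distribʳ = λ q p p′ → ⊗-distribʳ p p′ q
    ; zeroˡ = λ _ → ≋-refl })
  }

module PolySolver = NaturalCoefficientsSolver polySemiring

open import Algebra.Definitions.RawSemiring (CommutativeSemiring.rawSemiring polySemiring) using (_^_)
module ≋-Reasoning = Relation.Binary.Reasoning.Setoid (CommutativeSemiring.setoid polySemiring)

-- q-binomial coefficients as generating functions of shuffles

qPow-+ : ∀ a b → qPow (a ℕ.+ b) ≋ (qPow a ⊗ qPow b)
qPow-+ zero    b = ≋-sym (⊗-identityˡ (qPow b))
qPow-+ (suc a) b = ≋-trans (∷-cong refl (qPow-+ a b)) (≋-sym (⊗-shiftˡ (qPow a) (qPow b)))

qInt-+ : ∀ a b → qInt (a ℕ.+ b) ≋ (qInt a ⊕ (qPow a ⊗ qInt b))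
qInt-+ zero    b = ≋-sym (⊗-identityˡ (qInt b))
qInt-+ (suc a) b = ≋-trans (∷-cong refl (qInt-+ a b))
  (⊕-cong (≋-refl {1 ∷ qInt a}) (≋-sym (⊗-shiftˡ (qPow a) (qInt b))))

module _ (H : ℕ → ℕ → Poly) (e₁ e₂ : ℕ → ℕ → ℕ)
         (H-zeroʳ : ∀ m → H m 0 ≋ [ 1 ])
         (H-zeroˡ : ∀ n → H 0 n ≋ [ 1 ])
         (H-pascal : ∀ m n → H (suc m) (suc n) ≋
            ((qPow (e₁ m n) ⊗ H m (suc n)) ⊕ (qPow (e₂ m n) ⊗ H (suc m) n)))
         (qInt-pascal : ∀ m n → ((qPow (e₁ m n) ⊗ qInt (suc m)) ⊕ (qPow (e₂ m n) ⊗ qInt (suc n)))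
            ≋ qInt (suc (suc (m ℕ.+ n))))
         where

  pascal⇒qBinomial : ∀ m n → (H m n ⊗ (qFact m ⊗ qFact n)) ≋ qFact (m ℕ.+ n)
  pascal⇒qBinomial m zero = begin
    H m 0 ⊗ (qFact m ⊗ [ 1 ])   ≈⟨ ⊗-cong (H-zeroʳ m) (⊗-identityʳ (qFact m)) ⟩
    [ 1 ] ⊗ qFact m             ≈⟨ ⊗-identityˡ (qFact m) ⟩
    qFact m                     ≡⟨ cong qFact (ℕₚ.+-identityʳ m) ⟨
    qFact (m ℕ.+ 0)             ∎
    where open ≋-Reasoning
  pascal⇒qBinomial zero (suc n) = begin
    H 0 (suc n) ⊗ ([ 1 ] ⊗ qFact (suc n))   ≈⟨ ⊗-cong (H-zeroˡ (suc n)) (⊗-identityˡ (qFact (suc n))) ⟩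
    [ 1 ] ⊗ qFact (suc n)                   ≈⟨ ⊗-identityˡ (qFact (suc n)) ⟩
    qFact (suc n)                           ∎
    where open ≋-Reasoning
  pascal⇒qBinomial (suc m) (suc n) = begin
    H (suc m) (suc n) ⊗ ((Fm ⊗ Im) ⊗ (Fn ⊗ In))
      ≈⟨ ⊗-congˡ _ (H-pascal m n) ⟩
    ((A ⊗ H m (suc n)) ⊕ (B ⊗ H (suc m) n)) ⊗ ((Fm ⊗ Im) ⊗ (Fn ⊗ In))
      ≈⟨ regroup A B (H m (suc n)) (H (suc m) n) Fm Fn Im In ⟩
    ((A ⊗ Im) ⊗ (H m (suc n) ⊗ (Fm ⊗ (Fn ⊗ In)))) ⊕ ((B ⊗ In) ⊗ (H (suc m) n ⊗ ((Fm ⊗ Im) ⊗ Fn)))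
      ≈⟨ ⊕-cong (⊗-congʳ (A ⊗ Im) left) (⊗-congʳ (B ⊗ In) (pascal⇒qBinomial (suc m) n)) ⟩
    ((A ⊗ Im) ⊗ T) ⊕ ((B ⊗ In) ⊗ T)
      ≈⟨ factor (A ⊗ Im) (B ⊗ In) T ⟩
    T ⊗ ((A ⊗ Im) ⊕ (B ⊗ In))
      ≈⟨ ⊗-congʳ T (qInt-pascal m n) ⟩
    T ⊗ qInt (suc (suc (m ℕ.+ n)))
      ≡⟨ cong (λ k → qFact k ⊗ qInt (suc k)) (ℕₚ.+-suc m n) ⟨
    qFact (suc m ℕ.+ suc n) ∎
    where
    open ≋-Reasoning
    open PolySolver using (solve; _:=_; _:+_; _:*_)
    A = qPow (e₁ m n)
    B = qPow (e₂ m n)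
    Fm = qFact m
    Fn = qFact n
    Im = qInt (suc m)
    In = qInt (suc n)
    T = qFact (suc (m ℕ.+ n))
    left : (H m (suc n) ⊗ (Fm ⊗ (Fn ⊗ In))) ≋ T
    left = ≋-trans (pascal⇒qBinomial m (suc n)) (≡⇒≋ (cong qFact (ℕₚ.+-suc m n)))
    regroup : ∀ a b x y fm fn im in′ →
      (((a ⊗ x) ⊕ (b ⊗ y)) ⊗ ((fm ⊗ im) ⊗ (fn ⊗ in′))) ≋
      (((a ⊗ im) ⊗ (x ⊗ (fm ⊗ (fn ⊗ in′)))) ⊕ ((b ⊗ in′) ⊗ (y ⊗ ((fm ⊗ im) ⊗ fn))))
    regroup = solve 8 (λ a b x y fm fn im in′ →
      ((a :* x) :+ (b :* y)) :* ((fm :* im) :* (fn :* in′)) :=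
      ((a :* im) :* (x :* (fm :* (fn :* in′)))) :+ ((b :* in′) :* (y :* ((fm :* im) :* fn)))) ≋-refl
    factor : ∀ x y t → ((x ⊗ t) ⊕ (y ⊗ t)) ≋ (t ⊗ (x ⊕ y))
    factor = solve 3 (λ x y t → (x :* t) :+ (y :* t) := t :* (x :+ y)) ≋-refl

Σₚ : List Poly → Poly
Σₚ = foldr _⊕_ []

Σₚ-++ : ∀ ps qs → Σₚ (ps ++ qs) ≋ (Σₚ ps ⊕ Σₚ qs)
Σₚ-++ []       qs = ≋-refl
Σₚ-++ (p ∷ ps) qs = ≋-trans (⊕-cong (≋-refl {p}) (Σₚ-++ ps qs)) (≋-sym (⊕-assoc p (Σₚ ps) (Σₚ qs)))

Σₚ-map-cong : ∀ {A : Set} {f g : A → Poly} → (∀ x → f x ≋ g x) → ∀ xs → Σₚ (map f xs) ≋ Σₚ (map g xs)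
Σₚ-map-cong f≋g []       = ≋-refl
Σₚ-map-cong f≋g (x ∷ xs) = ⊕-cong (f≋g x) (Σₚ-map-cong f≋g xs)

Σₚ-⊗ˡ : ∀ {A : Set} c (f : A → Poly) xs → Σₚ (map (λ x → c ⊗ f x) xs) ≋ (c ⊗ Σₚ (map f xs))
Σₚ-⊗ˡ c f []       = ≋-sym (⊗-zeroʳ c)
Σₚ-⊗ˡ c f (x ∷ xs) = begin
  (c ⊗ f x) ⊕ Σₚ (map (λ x → c ⊗ f x) xs) ≈⟨ ⊕-cong (≋-refl {c ⊗ f x}) (Σₚ-⊗ˡ c f xs) ⟩
  (c ⊗ f x) ⊕ (c ⊗ Σₚ (map f xs))         ≈⟨ ⊗-distribˡ c (f x) (Σₚ (map f xs)) ⟨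
  c ⊗ (f x ⊕ Σₚ (map f xs))               ∎
  where
  open ≋-Reasoning
  open CommutativeSemiring polySemiring using () renaming (distribˡ to ⊗-distribˡ)

Σₚ-qPow-+ : ∀ {A : Set} c (f : A → ℕ) xs →
  Σₚ (map (λ x → qPow (c ℕ.+ f x)) xs) ≋ (qPow c ⊗ Σₚ (map (qPow ∘ f) xs))
Σₚ-qPow-+ c f xs = ≋-trans (Σₚ-map-cong (λ x → qPow-+ c (f x)) xs) (Σₚ-⊗ˡ (qPow c) (qPow ∘ f) xs)

-- Counts the pairs (left column, right column) in which the left one comes first.
pairsLR : ∀ {m n} → Shuffle m n → ℕ
pairsLR done              = 0
pairsLR {n = n} (takeL σ) = n ℕ.+ pairsLR σ
pairsLR (takeR σ)         = pairsLR σ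

pairsRL : ∀ {m n} → Shuffle m n → ℕ
pairsRL done              = 0
pairsRL (takeL σ)         = pairsRL σ
pairsRL {m = m} (takeR σ) = m ℕ.+ pairsRL σ

shuffleGF : (∀ {m n} → Shuffle m n → ℕ) → ℕ → ℕ → Poly
shuffleGF X m n = Σₚ (map (λ σ → qPow (X σ)) (allShuffles m n))

module _ (X : ∀ {m n} → Shuffle m n → ℕ) where

  shuffleGF-split : ∀ m n → shuffleGF X (suc m) (suc n) ≋
    (Σₚ (map (λ σ → qPow (X (takeL σ))) (allShuffles m (suc n))) ⊕
     Σₚ (map (λ σ → qPow (X (takeR σ))) (allShuffles (suc m) n)))
  shuffleGF-split m n = begin
    Σₚ (map term (map takeL Ls ++ map takeR Rs))
      ≡⟨ cong Σₚ (Listₚ.map-++ term (map takeL Ls) (map takeR Rs)) ⟩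
    Σₚ (map term (map takeL Ls) ++ map term (map takeR Rs))
      ≈⟨ Σₚ-++ (map term (map takeL Ls)) (map term (map takeR Rs)) ⟩
    Σₚ (map term (map takeL Ls)) ⊕ Σₚ (map term (map takeR Rs))
      ≡⟨ cong₂ (λ l r → Σₚ l ⊕ Σₚ r) (Listₚ.map-∘ Ls) (Listₚ.map-∘ Rs) ⟨
    Σₚ (map (term ∘ takeL) Ls) ⊕ Σₚ (map (term ∘ takeR) Rs) ∎
    where
    open ≋-Reasoning
    term : ∀ {m n} → Shuffle m n → Poly
    term σ = qPow (X σ)
    Ls = allShuffles m (suc n)
    Rs = allShuffles (suc m) n

  shuffleGF-zeroʳ : X done ≡ 0 → (∀ {m} (σ : Shuffle m 0) → X (takeL σ) ≡ X σ) → ∀ m → shuffleGF X m 0 ≋ [ 1 ]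
  shuffleGF-zeroʳ X-done X-takeL zero    = ≋-trans (⊕-identityʳ _) (≡⇒≋ (cong qPow X-done))
  shuffleGF-zeroʳ X-done X-takeL (suc m) = begin
    Σₚ (map (λ σ → qPow (X σ)) (map takeL (allShuffles m 0)))
      ≡⟨ cong Σₚ (Listₚ.map-∘ (allShuffles m 0)) ⟨
    Σₚ (map (λ σ → qPow (X (takeL σ))) (allShuffles m 0))
      ≡⟨ cong Σₚ (Listₚ.map-cong (cong qPow ∘ X-takeL) (allShuffles m 0)) ⟩
    shuffleGF X m 0
      ≈⟨ shuffleGF-zeroʳ X-done X-takeL m ⟩
    [ 1 ] ∎
    where open ≋-Reasoning

  shuffleGF-zeroˡ : X done ≡ 0 → (∀ {n} (σ : Shuffle 0 n) → X (takeR σ) ≡ X σ) → ∀ n → shuffleGF X 0 n ≋ [ 1 ]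
  shuffleGF-zeroˡ X-done X-takeR zero    = ≋-trans (⊕-identityʳ _) (≡⇒≋ (cong qPow X-done))
  shuffleGF-zeroˡ X-done X-takeR (suc n) = begin
    Σₚ (map (λ σ → qPow (X σ)) (map takeR (allShuffles 0 n)))
      ≡⟨ cong Σₚ (Listₚ.map-∘ (allShuffles 0 n)) ⟨
    Σₚ (map (λ σ → qPow (X (takeR σ))) (allShuffles 0 n))
      ≡⟨ cong Σₚ (Listₚ.map-cong (cong qPow ∘ X-takeR) (allShuffles 0 n)) ⟩
    shuffleGF X 0 n
      ≈⟨ shuffleGF-zeroˡ X-done X-takeR n ⟩
    [ 1 ] ∎
    where open ≋-Reasoning

shuffleGF-pairsLR : ∀ m n → (shuffleGF pairsLR m n ⊗ (qFact m ⊗ qFact n)) ≋ qFact (m ℕ.+ n)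
shuffleGF-pairsLR = pascal⇒qBinomial (shuffleGF pairsLR) (λ _ n → suc n) (λ _ _ → 0)
  (shuffleGF-zeroʳ pairsLR refl (λ _ → refl)) (shuffleGF-zeroˡ pairsLR refl (λ _ → refl))
  (λ m n → ≋-trans (shuffleGF-split pairsLR m n)
    (⊕-cong (Σₚ-qPow-+ (suc n) pairsLR (allShuffles m (suc n))) (≋-sym (⊗-identityˡ _))))
  (λ m n → begin
    (qPow (suc n) ⊗ qInt (suc m)) ⊕ ([ 1 ] ⊗ qInt (suc n))
      ≈⟨ ⊕-comm (qPow (suc n) ⊗ qInt (suc m)) ([ 1 ] ⊗ qInt (suc n)) ⟩
    ([ 1 ] ⊗ qInt (suc n)) ⊕ (qPow (suc n) ⊗ qInt (suc m))
      ≈⟨ ⊕-cong (⊗-identityˡ (qInt (suc n))) (≋-refl {qPow (suc n) ⊗ qInt (suc m)}) ⟩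
    qInt (suc n) ⊕ (qPow (suc n) ⊗ qInt (suc m))
      ≈⟨ qInt-+ (suc n) (suc m) ⟨
    qInt (suc n ℕ.+ suc m)
      ≡⟨ cong (qInt ∘ suc) (trans (ℕₚ.+-suc n m) (cong suc (ℕₚ.+-comm n m))) ⟩
    qInt (suc (suc (m ℕ.+ n))) ∎)
  where open ≋-Reasoning

shuffleGF-pairsRL : ∀ m n → (shuffleGF pairsRL m n ⊗ (qFact m ⊗ qFact n)) ≋ qFact (m ℕ.+ n)
shuffleGF-pairsRL = pascal⇒qBinomial (shuffleGF pairsRL) (λ _ _ → 0) (λ m _ → suc m)
  (shuffleGF-zeroʳ pairsRL refl (λ _ → refl)) (shuffleGF-zeroˡ pairsRL refl (λ _ → refl))
  (λ m n → ≋-trans (shuffleGF-split pairsRL m n)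
    (⊕-cong (≋-sym (⊗-identityˡ _)) (Σₚ-qPow-+ (suc m) pairsRL (allShuffles (suc m) n))))
  (λ m n → begin
    ([ 1 ] ⊗ qInt (suc m)) ⊕ (qPow (suc m) ⊗ qInt (suc n))
      ≈⟨ ⊕-cong (⊗-identityˡ (qInt (suc m))) (≋-refl {qPow (suc m) ⊗ qInt (suc n)}) ⟩
    qInt (suc m) ⊕ (qPow (suc m) ⊗ qInt (suc n))
      ≈⟨ qInt-+ (suc m) (suc n) ⟨
    qInt (suc m ℕ.+ suc n)
      ≡⟨ cong (qInt ∘ suc) (ℕₚ.+-suc m n) ⟩
    qInt (suc (suc (m ℕ.+ n))) ∎)
  where open ≋-Reasoning

map≢[] : ∀ {A B : Set} {f : A → B} {xs} → xs ≢ [] → map f xs ≢ []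
map≢[] {xs = []}    xs≢[] _ = xs≢[] refl
map≢[] {xs = _ ∷ _} _     ()

++≢[] : ∀ {A : Set} {xs ys : List A} → xs ≢ [] → xs ++ ys ≢ []
++≢[] {xs = []}    xs≢[] _ = xs≢[] refl
++≢[] {xs = _ ∷ _} _     ()

allShuffles≢[] : ∀ m n → allShuffles m n ≢ []
allShuffles≢[] zero    zero    ()
allShuffles≢[] (suc m) zero    = map≢[] (allShuffles≢[] m zero)
allShuffles≢[] zero    (suc n) = map≢[] (allShuffles≢[] zero n)
allShuffles≢[] (suc m) (suc n) = ++≢[] (map≢[] (allShuffles≢[] m (suc n)))

module _ {A : Set} (f : A → Poly) (D : Poly) where

  private
    fractions : List A → List RatFun
    fractions = map (λ x → f x / D)

  den-sumᵣ-fractions : ∀ xs → den (sumᵣ (fractions xs)) ≋ (D ^ length xs)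
  den-sumᵣ-fractions []       = ≋-refl
  den-sumᵣ-fractions (x ∷ xs) = ⊗-congʳ D (den-sumᵣ-fractions xs)

  num-sumᵣ-fractions : ∀ x xs → num (sumᵣ (fractions (x ∷ xs))) ≋ (Σₚ (map f (x ∷ xs)) ⊗ (D ^ length xs))
  num-sumᵣ-fractions x []       = ≋-trans (⊕-identityʳ _) (⊗-congˡ [ 1 ] (≋-sym (⊕-identityʳ (f x))))
  num-sumᵣ-fractions x (y ∷ xs) = begin
    (f x ⊗ den S) ⊕ (num S ⊗ D)
      ≈⟨ ⊕-cong (⊗-congʳ (f x) (den-sumᵣ-fractions (y ∷ xs))) (⊗-congˡ D (num-sumᵣ-fractions y xs)) ⟩
    (f x ⊗ (D ^ suc (length xs))) ⊕ ((Σₚ (map f (y ∷ xs)) ⊗ (D ^ length xs)) ⊗ D)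
      ≈⟨ collect (f x) (Σₚ (map f (y ∷ xs))) D (D ^ length xs) ⟩
    (f x ⊕ Σₚ (map f (y ∷ xs))) ⊗ (D ^ suc (length xs)) ∎
    where
    open ≋-Reasoning
    open PolySolver using (solve; _:=_; _:+_; _:*_)
    S = sumᵣ (fractions (y ∷ xs))
    collect : ∀ a b d w → ((a ⊗ (d ⊗ w)) ⊕ ((b ⊗ w) ⊗ d)) ≋ ((a ⊕ b) ⊗ (d ⊗ w))
    collect = solve 4 (λ a b d w → (a :* (d :* w)) :+ ((b :* w) :* d) := (a :+ b) :* (d :* w)) ≋-refl

  -- Cross-multiplication is not transitive on `RatFun` without cancellation, hence the
  -- detour through the explicit numerator and denominator.
  sumᵣ-fractions-≃ : ∀ xs → xs ≢ [] → ∀ r → (Σₚ (map f xs) / D) ≃ r → sumᵣ (fractions xs) ≃ r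
  sumᵣ-fractions-≃ []       []≢[] r _       = ⊥-elim ([]≢[] refl)
  sumᵣ-fractions-≃ (x ∷ xs) _     r ⟨Σ⟩≃r = coeff-≡ (begin
    num S ⊗ den r                  ≈⟨ ⊗-congˡ (den r) (num-sumᵣ-fractions x xs) ⟩
    (Σ ⊗ (D ^ length xs)) ⊗ den r  ≈⟨ swap Σ (D ^ length xs) (den r) ⟩
    (Σ ⊗ den r) ⊗ (D ^ length xs)  ≈⟨ ⊗-congˡ {Σ ⊗ den r} {num r ⊗ D} (D ^ length xs) ⟨ ⟨Σ⟩≃r ⟩ ⟩
    (num r ⊗ D) ⊗ (D ^ length xs)  ≈⟨ ⊗-assoc (num r) D (D ^ length xs) ⟩
    num r ⊗ (D ^ suc (length xs))  ≈⟨ ⊗-congʳ (num r) (den-sumᵣ-fractions (x ∷ xs)) ⟨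
    num r ⊗ den S                  ∎)
    where
    open ≋-Reasoning
    open PolySolver using (solve; _:=_; _:*_)
    S = sumᵣ (fractions (x ∷ xs))
    Σ = Σₚ (map f (x ∷ xs))
    swap : ∀ a b c → ((a ⊗ b) ⊗ c) ≋ ((a ⊗ c) ⊗ b)
    swap = solve 3 (λ a b c → (a :* b) :* c := (a :* c) :* b) ≋-refl

sum-↑ : ∀ p {q} (h : Fin (p ℕ.+ q) → ℕ) → sum h ≡ sum (h ∘ (_↑ˡ q)) ℕ.+ sum (h ∘ (p ↑ʳ_))
sum-↑ zero    h = refl
sum-↑ (suc p) h = trans (cong (h zero ℕ.+_) (sum-↑ p (h ∘ suc))) (sym (ℕₚ.+-assoc (h zero) _ _))

⟦_⟧ : Bool → ℕ
⟦ true ⟧  = 1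
⟦ false ⟧ = 0

countBool-∷ : ∀ b bs → countBool (b ∷ bs) ≡ ⟦ b ⟧ ℕ.+ countBool bs
countBool-∷ true  bs = refl
countBool-∷ false bs = refl

countBool-++ : ∀ bs cs → countBool (bs ++ cs) ≡ countBool bs ℕ.+ countBool cs
countBool-++ []           cs = refl
countBool-++ (true ∷ bs)  cs = cong suc (countBool-++ bs cs)
countBool-++ (false ∷ bs) cs = countBool-++ bs cs

countBool-tabulate : ∀ {n} (g : Fin n → Bool) → countBool (tabulate g) ≡ sum (⟦_⟧ ∘ g)
countBool-tabulate {zero}  g = refl
countBool-tabulate {suc n} g =
  trans (countBool-∷ (g zero) _) (cong (⟦ g zero ⟧ ℕ.+_) (countBool-tabulate (g ∘ suc)))

countBool-concat-tabulate : ∀ {n} (g : Fin n → List Bool) →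
  countBool (concat (tabulate g)) ≡ sum (countBool ∘ g)
countBool-concat-tabulate {zero}  g = refl
countBool-concat-tabulate {suc n} g =
  trans (countBool-++ (g zero) _) (cong (countBool (g zero) ℕ.+_) (countBool-concat-tabulate (g ∘ suc)))

map-allFin : ∀ {A : Set} {n} (g : Fin n → A) → map g (allFin n) ≡ tabulate g
map-allFin g = Listₚ.map-tabulate id g

allFin-suc : ∀ n → allFin (suc n) ≡ zero ∷ map suc (allFin n)
allFin-suc n = cong (zero ∷_) (sym (map-allFin suc))

sumℤ : List ℤ → ℤ
sumℤ = foldr ℤ._+_ (+ 0)

prefixSum : ∀ {n} → (Fin n → ℤ) → ℕ → ℤ
prefixSum f k = sumℤ (take k (tabulate f))

prefixSum-all : ∀ {n} (f : Fin n → ℤ) → prefixSum f n ≡ sumℤ (tabulate f)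
prefixSum-all {zero}  f = refl
prefixSum-all {suc n} f = cong (ℤ._+_ (f zero)) (prefixSum-all (f ∘ suc))

aStat≡prefixSum : ∀ {n} (δ : Mat n) i j → aStat δ i j ≡ prefixSum (δ i) (toℕ j)
aStat≡prefixSum δ i j = cong (sumℤ ∘ take (toℕ j)) (map-allFin (δ i))

bStat≡prefixSum : ∀ {n} (δ : Mat n) i j → bStat δ i j ≡ prefixSum (λ i′ → δ i′ j) (toℕ i)
bStat≡prefixSum δ i j = cong (sumℤ ∘ take (toℕ i)) (map-allFin (λ i′ → δ i′ j))

prefixSum-cong : ∀ {n} {f g : Fin n → ℤ} → (∀ i → f i ≡ g i) → ∀ k → prefixSum f k ≡ prefixSum g k
prefixSum-cong f≗g k = cong (sumℤ ∘ take k) (Listₚ.tabulate-cong f≗g)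

prefixSum-zero : ∀ {n} k → prefixSum {n} (λ _ → + 0) k ≡ + 0
prefixSum-zero {zero}  zero    = refl
prefixSum-zero {zero}  (suc k) = refl
prefixSum-zero {suc n} zero    = refl
prefixSum-zero {suc n} (suc k) = trans (ℤₚ.+-identityˡ _) (prefixSum-zero {n} k)

prefixSum-+ : ∀ {n} (f g : Fin n → ℤ) k → prefixSum (λ i → f i ℤ.+ g i) k ≡ prefixSum f k ℤ.+ prefixSum g k
prefixSum-+ {zero}  f g zero    = refl
prefixSum-+ {zero}  f g (suc k) = refl
prefixSum-+ {suc n} f g zero    = refl
prefixSum-+ {suc n} f g (suc k) = trans (cong (ℤ._+_ (f zero ℤ.+ g zero)) (prefixSum-+ (f ∘ suc) (g ∘ suc) k))
  (ℤ+.interchange (f zero) (g zero) _ _)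

prefixSum-↑ˡ : ∀ {p q} (v : Fin (p ℕ.+ q) → ℤ) (i : Fin p) →
  prefixSum v (toℕ (i ↑ˡ q)) ≡ prefixSum (v ∘ (_↑ˡ q)) (toℕ i)
prefixSum-↑ˡ v zero    = refl
prefixSum-↑ˡ v (suc i) = cong (ℤ._+_ (v zero)) (prefixSum-↑ˡ (v ∘ suc) i)

prefixSum-↑ʳ : ∀ p {q} (v : Fin (p ℕ.+ q) → ℤ) k →
  prefixSum v (p ℕ.+ k) ≡ prefixSum (v ∘ (_↑ˡ q)) p ℤ.+ prefixSum (v ∘ (p ↑ʳ_)) k
prefixSum-↑ʳ zero    v k = sym (ℤₚ.+-identityˡ _)
prefixSum-↑ʳ (suc p) v k =
  trans (cong (ℤ._+_ (v zero)) (prefixSum-↑ʳ p (v ∘ suc) k)) (sym (ℤₚ.+-assoc (v zero) _ _))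

-- Counting entries of a given type column by column

hasType : Stat → ℤ → ℤ → ℤ → Bool
hasType s x a b = ⌊ x ℤ.≟ + 0 ⌋ ∧ ⌊ a ℤ.≟ proj₁ (pattern′ s) ⌋ ∧ ⌊ b ℤ.≟ proj₂ (pattern′ s) ⌋

isOfType≡hasType : ∀ s {n} (δ : Mat n) i j →
  isOfType s δ i j ≡ hasType s (δ i j) (aStat δ i j) (bStat δ i j)
isOfType≡hasType se δ i j = refl
isOfType≡hasType nw δ i j = refl
isOfType≡hasType sw δ i j = refl
isOfType≡hasType ne δ i j = refl

_ᵀ : ∀ {p m} → (Fin p → Fin m → ℤ) → Fin m → Fin p → ℤ
(δ ᵀ) j i = δ i j

shiftCols : ∀ {p m} → (Fin p → Fin (suc m) → ℤ) → Fin p → Fin m → ℤ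
shiftCols δ i j = δ i (suc j)

advance : ∀ {p m} → (Fin p → ℤ) → (Fin p → Fin (suc m) → ℤ) → Fin p → ℤ
advance α δ i = α i ℤ.+ δ i zero

blockDiag : ∀ {p q m n} → (Fin p → Fin m → ℤ) → (Fin q → Fin n → ℤ) → Fin p ⊎ Fin q → Fin m ⊎ Fin n → ℤ
blockDiag δ₁ δ₂ (inj₁ i) (inj₁ j) = δ₁ i j
blockDiag δ₁ δ₂ (inj₂ i) (inj₂ j) = δ₂ i j
blockDiag δ₁ δ₂ (inj₁ _) (inj₂ _) = + 0
blockDiag δ₁ δ₂ (inj₂ _) (inj₁ _) = + 0

blockColumn : ∀ {p q m n} → (Fin p → Fin m → ℤ) → (Fin q → Fin n → ℤ) → Fin m ⊎ Fin n → Fin (p ℕ.+ q) → ℤ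
blockColumn {p} δ₁ δ₂ x r = blockDiag δ₁ δ₂ (splitAt p r) x

joinRows : ∀ {p q} → (Fin p → ℤ) → (Fin q → ℤ) → Fin (p ℕ.+ q) → ℤ
joinRows {p} α₁ α₂ r = [ α₁ , α₂ ]′ (splitAt p r)

shuffleMat≡blockColumn : ∀ {m n} (σ : Shuffle m n) (δ₁ : Mat m) (δ₂ : Mat n) r c →
  shuffleMat σ δ₁ δ₂ r c ≡ blockColumn δ₁ δ₂ (colSource σ c) r
shuffleMat≡blockColumn {m} σ δ₁ δ₂ r c with splitAt m r | colSource σ c
... | inj₁ i | inj₁ j = refl
... | inj₂ i | inj₂ j = refl
... | inj₁ i | inj₂ j = refl
... | inj₂ i | inj₁ j = refl

module _ {p q m n} (δ₁ : Fin p → Fin m → ℤ) (δ₂ : Fin q → Fin n → ℤ) where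

  blockColumn-↑ˡ : ∀ x i → blockColumn δ₁ δ₂ x (i ↑ˡ q) ≡ blockDiag δ₁ δ₂ (inj₁ i) x
  blockColumn-↑ˡ x i = cong (λ y → blockDiag δ₁ δ₂ y x) (Finₚ.splitAt-↑ˡ p i q)

  blockColumn-↑ʳ : ∀ x i → blockColumn δ₁ δ₂ x (p ↑ʳ i) ≡ blockDiag δ₁ δ₂ (inj₂ i) x
  blockColumn-↑ʳ x i = cong (λ y → blockDiag δ₁ δ₂ y x) (Finₚ.splitAt-↑ʳ p q i)

joinRows-↑ˡ : ∀ {p q} (α₁ : Fin p → ℤ) (α₂ : Fin q → ℤ) i → joinRows α₁ α₂ (i ↑ˡ q) ≡ α₁ i
joinRows-↑ˡ {p} {q} α₁ α₂ i = cong [ α₁ , α₂ ]′ (Finₚ.splitAt-↑ˡ p i q)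

joinRows-↑ʳ : ∀ {p q} (α₁ : Fin p → ℤ) (α₂ : Fin q → ℤ) i → joinRows α₁ α₂ (p ↑ʳ i) ≡ α₂ i
joinRows-↑ʳ {p} {q} α₁ α₂ i = cong [ α₁ , α₂ ]′ (Finₚ.splitAt-↑ʳ p q i)

module _ {p q m n} (δ₁ : Fin p → Fin (suc m) → ℤ) (δ₂ : Fin q → Fin n → ℤ) (α₁ : Fin p → ℤ) (α₂ : Fin q → ℤ) where

  blockDiag-map₁ : ∀ y x → blockDiag δ₁ δ₂ y (Sum.map₁ suc x) ≡ blockDiag (shiftCols δ₁) δ₂ y x
  blockDiag-map₁ (inj₁ i) (inj₁ j) = refl
  blockDiag-map₁ (inj₁ i) (inj₂ j) = refl
  blockDiag-map₁ (inj₂ i) (inj₁ j) = refl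
  blockDiag-map₁ (inj₂ i) (inj₂ j) = refl

  join-advance₁ : ∀ y → [ α₁ , α₂ ]′ y ℤ.+ blockDiag δ₁ δ₂ y (inj₁ zero) ≡ [ advance α₁ δ₁ , α₂ ]′ y
  join-advance₁ (inj₁ i) = refl
  join-advance₁ (inj₂ i) = ℤₚ.+-identityʳ (α₂ i)

module _ {p q m n} (δ₁ : Fin p → Fin m → ℤ) (δ₂ : Fin q → Fin (suc n) → ℤ) (α₁ : Fin p → ℤ) (α₂ : Fin q → ℤ) where

  blockDiag-map₂ : ∀ y x → blockDiag δ₁ δ₂ y (Sum.map₂ suc x) ≡ blockDiag δ₁ (shiftCols δ₂) y x
  blockDiag-map₂ (inj₁ i) (inj₁ j) = refl
  blockDiag-map₂ (inj₁ i) (inj₂ j) = refl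
  blockDiag-map₂ (inj₂ i) (inj₁ j) = refl
  blockDiag-map₂ (inj₂ i) (inj₂ j) = refl

  join-advance₂ : ∀ y → [ α₁ , α₂ ]′ y ℤ.+ blockDiag δ₁ δ₂ y (inj₂ zero) ≡ [ α₁ , advance α₂ δ₂ ]′ y
  join-advance₂ (inj₁ i) = ℤₚ.+-identityʳ (α₁ i)
  join-advance₂ (inj₂ i) = refl

columnSources : ∀ {m n} → Shuffle m n → List (Fin m ⊎ Fin n)
columnSources σ = tabulate (colSource σ)

columnSources-takeL : ∀ {m n} (σ : Shuffle m n) →
  columnSources (takeL σ) ≡ inj₁ zero ∷ map (Sum.map₁ suc) (columnSources σ)
columnSources-takeL σ = cong (inj₁ zero ∷_) (sym (Listₚ.map-tabulate (colSource σ) (Sum.map₁ suc)))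

tabulate-∘-cast : ∀ {A : Set} {a b} (e : a ≡ b) (h : Fin b → A) → tabulate (h ∘ cast e) ≡ tabulate h
tabulate-∘-cast refl h = Listₚ.tabulate-cong (λ i → cong h (Finₚ.cast-is-id refl i))

columnSources-takeR : ∀ {m n} (σ : Shuffle m n) →
  columnSources (takeR σ) ≡ inj₂ zero ∷ map (Sum.map₂ suc) (columnSources σ)
columnSources-takeR {m} {n} σ = begin
  tabulate (colSource (takeR σ))
    ≡⟨ Listₚ.tabulate-cong colSource-takeR ⟩
  tabulate (afterFirst ∘ cast (ℕₚ.+-suc m n))
    ≡⟨ tabulate-∘-cast (ℕₚ.+-suc m n) afterFirst ⟩
  tabulate afterFirst
    ≡⟨ cong (inj₂ zero ∷_) (Listₚ.map-tabulate (colSource σ) (Sum.map₂ suc)) ⟨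
  inj₂ zero ∷ map (Sum.map₂ suc) (columnSources σ) ∎
  where
  open ≡-Reasoning
  afterFirst : Fin (suc (m ℕ.+ n)) → Fin m ⊎ Fin (suc n)
  afterFirst zero    = inj₂ zero
  afterFirst (suc k) = Sum.map₂ suc (colSource σ k)
  colSource-takeR : ∀ c → colSource (takeR σ) c ≡ afterFirst (cast (ℕₚ.+-suc m n) c)
  colSource-takeR c with cast (ℕₚ.+-suc m n) c
  ... | zero  = refl
  ... | suc k = refl

module _ (s : Stat) where

  ⟦hasType⟧-cong : ∀ {x x′ a a′ b b′} → x ≡ x′ → a ≡ a′ → b ≡ b′ → ⟦ hasType s x a b ⟧ ≡ ⟦ hasType s x′ a′ b′ ⟧
  ⟦hasType⟧-cong refl refl refl = refl

  -- Counts the entries of type s in the R-row matrix whose columns are `col x` for x in xs,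
  -- given that the entries of row r to the left of these columns sum to α r.
  countColumns : ∀ {X : Set} {R} → (X → Fin R → ℤ) → (Fin R → ℤ) → List X → ℕ
  countColumns col α []       = 0
  countColumns col α (x ∷ xs) =
    sum (λ r → ⟦ hasType s (col x r) (α r) (prefixSum (col x) (toℕ r)) ⟧) ℕ.+
    countColumns col (λ r → α r ℤ.+ col x r) xs

  countColumns-map : ∀ {X Y : Set} {R} (col : Y → Fin R → ℤ) (g : X → Y) α xs →
    countColumns col α (map g xs) ≡ countColumns (col ∘ g) α xs
  countColumns-map col g α []       = refl
  countColumns-map col g α (x ∷ xs) = cong (_ ℕ.+_) (countColumns-map col g _ xs)

  countColumns-cong : ∀ {X : Set} {R} {col col′ : X → Fin R → ℤ} {α α′ : Fin R → ℤ} →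
    (∀ x r → col x r ≡ col′ x r) → (∀ r → α r ≡ α′ r) → ∀ xs → countColumns col α xs ≡ countColumns col′ α′ xs
  countColumns-cong col≗col′ α≗α′ []       = refl
  countColumns-cong col≗col′ α≗α′ (x ∷ xs) = cong₂ ℕ._+_
    (sum-cong-≗ (λ r → ⟦hasType⟧-cong (col≗col′ x r) (α≗α′ r) (prefixSum-cong (col≗col′ x) (toℕ r))))
    (countColumns-cong col≗col′ (λ r → cong₂ ℤ._+_ (α≗α′ r) (col≗col′ x r)) xs)

  countColumns-ᵀ-suc : ∀ {p m} (δ : Fin p → Fin (suc m) → ℤ) α →
    countColumns (δ ᵀ) α (allFin (suc m)) ≡
    sum (λ i → ⟦ hasType s (δ i zero) (α i) (prefixSum (λ i′ → δ i′ zero) (toℕ i)) ⟧) ℕ.+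
    countColumns (shiftCols δ ᵀ) (advance α δ) (allFin m)
  countColumns-ᵀ-suc {m = m} δ α = trans (cong (countColumns (δ ᵀ) α) (allFin-suc m))
    (cong₂ ℕ._+_ refl (countColumns-map (δ ᵀ) suc (advance α δ) (allFin m)))

  countColumns-allFin : ∀ {R C} (M : Fin R → Fin C → ℤ) (α : Fin R → ℤ) →
    sum (λ c → sum (λ r → ⟦ hasType s (M r c) (α r ℤ.+ prefixSum (M r) (toℕ c)) (prefixSum (λ i → M i c) (toℕ r)) ⟧))
      ≡ countColumns (M ᵀ) α (allFin C)
  countColumns-allFin {R} {zero}  M α = refl
  countColumns-allFin {R} {suc C} M α = begin
    sum (λ r → entry α M zero r) ℕ.+ sum (λ c → sum (λ r → entry α M (suc c) r))
      ≡⟨ cong₂ ℕ._+_ (sum-cong-≗ (λ r → cong (λ a → ⟦ hasType s (M r zero) a (b zero r) ⟧) (ℤₚ.+-identityʳ (α r))))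
                     (sum-cong-≗ (λ c → sum-cong-≗ (λ r → cong (λ a → ⟦ hasType s (M r (suc c)) a (b (suc c) r) ⟧)
                       (sym (ℤₚ.+-assoc (α r) (M r zero) _))))) ⟩
    firstColumn ℕ.+ sum (λ c → sum (λ r → entry (advance α M) (shiftCols M) c r))
      ≡⟨ cong (firstColumn ℕ.+_) (countColumns-allFin (shiftCols M) (advance α M)) ⟩
    firstColumn ℕ.+ countColumns (shiftCols M ᵀ) (advance α M) (allFin C)
      ≡⟨ countColumns-ᵀ-suc M α ⟨
    countColumns (M ᵀ) α (allFin (suc C)) ∎
    where
    open ≡-Reasoning
    entry : ∀ {C} → (Fin R → ℤ) → (Fin R → Fin C → ℤ) → Fin C → Fin R → ℕ
    entry α M c r = ⟦ hasType s (M r c) (α r ℤ.+ prefixSum (M r) (toℕ c)) (prefixSum (λ i → M i c) (toℕ r)) ⟧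
    b : Fin (suc C) → Fin R → ℤ
    b c r = prefixSum (λ i → M i c) (toℕ r)
    firstColumn : ℕ
    firstColumn = sum (λ r → ⟦ hasType s (M r zero) (α r) (b zero r) ⟧)

  stat≡countColumns : ∀ {N} (M : Mat N) → stat s M ≡ countColumns (M ᵀ) (λ _ → + 0) (allFin N)
  stat≡countColumns {N} M = begin
    countBool (concat (map (λ i → map (isOfType s M i) (allFin N)) (allFin N)))
      ≡⟨ cong (countBool ∘ concat) (trans (map-allFin _) (Listₚ.tabulate-cong (λ i → map-allFin (isOfType s M i)))) ⟩
    countBool (concat (tabulate (λ i → tabulate (isOfType s M i))))
      ≡⟨ countBool-concat-tabulate (λ i → tabulate (isOfType s M i)) ⟩
    sum (λ i → countBool (tabulate (isOfType s M i)))
      ≡⟨ sum-cong-≗ (λ i → trans (countBool-tabulate (isOfType s M i)) (sum-cong-≗ (cong ⟦_⟧ ∘ isOfType≡entry i))) ⟩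
    sum (λ i → sum (λ j → ⟦ entry i j ⟧))
      ≡⟨ ∑-comm (λ i j → ⟦ entry i j ⟧) ⟩
    sum (λ j → sum (λ i → ⟦ entry i j ⟧))
      ≡⟨ countColumns-allFin M (λ _ → + 0) ⟩
    countColumns (M ᵀ) (λ _ → + 0) (allFin N) ∎
    where
    open ≡-Reasoning
    entry : Fin N → Fin N → Bool
    entry i j = hasType s (M i j) (+ 0 ℤ.+ prefixSum (M i) (toℕ j)) (prefixSum (λ i′ → M i′ j) (toℕ i))
    isOfType≡entry : ∀ i j → isOfType s M i j ≡ entry i j
    isOfType≡entry i j = trans (isOfType≡hasType s M i j)
      (cong₂ (hasType s (M i j)) (trans (aStat≡prefixSum M i j) (sym (ℤₚ.+-identityˡ _))) (bStat≡prefixSum M i j))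

  sum-rows-↑ : ∀ p {q} (v α : Fin (p ℕ.+ q) → ℤ) →
    sum (λ r → ⟦ hasType s (v r) (α r) (prefixSum v (toℕ r)) ⟧) ≡
    sum (λ i → ⟦ hasType s (v (i ↑ˡ q)) (α (i ↑ˡ q)) (prefixSum (v ∘ (_↑ˡ q)) (toℕ i)) ⟧) ℕ.+
    sum (λ i → ⟦ hasType s (v (p ↑ʳ i)) (α (p ↑ʳ i))
                          (prefixSum (v ∘ (_↑ˡ q)) p ℤ.+ prefixSum (v ∘ (p ↑ʳ_)) (toℕ i)) ⟧)
  sum-rows-↑ p {q} v α = trans (sum-↑ p (λ r → ⟦ hasType s (v r) (α r) (prefixSum v (toℕ r)) ⟧)) (cong₂ ℕ._+_
    (sum-cong-≗ (λ i → cong (λ b → ⟦ hasType s (v (i ↑ˡ q)) (α (i ↑ˡ q)) b ⟧) (prefixSum-↑ˡ v i)))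
    (sum-cong-≗ (λ i → cong (λ b → ⟦ hasType s (v (p ↑ʳ i)) (α (p ↑ʳ i)) b ⟧)
      (trans (cong (prefixSum v) (Finₚ.toℕ-↑ʳ p i)) (prefixSum-↑ʳ p v (toℕ i))))))

  module _ {p q m n} (δ₁ : Fin p → Fin (suc m) → ℤ) (δ₂ : Fin q → Fin n → ℤ) (α₁ : Fin p → ℤ) (α₂ : Fin q → ℤ) where

    sum-leftColumn :
      sum (λ r → ⟦ hasType s (blockColumn δ₁ δ₂ (inj₁ zero) r) (joinRows α₁ α₂ r)
                          (prefixSum (blockColumn δ₁ δ₂ (inj₁ zero)) (toℕ r)) ⟧) ≡
      sum (λ i → ⟦ hasType s (δ₁ i zero) (α₁ i) (prefixSum (λ i′ → δ₁ i′ zero) (toℕ i)) ⟧) ℕ.+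
      sum (λ i → ⟦ hasType s (+ 0) (α₂ i) (prefixSum (λ i′ → δ₁ i′ zero) p) ⟧)
    sum-leftColumn = trans (sum-rows-↑ p v (joinRows α₁ α₂)) (cong₂ ℕ._+_
      (sum-cong-≗ (λ i → ⟦hasType⟧-cong (top i) (joinRows-↑ˡ α₁ α₂ i) (prefixSum-cong top (toℕ i))))
      (sum-cong-≗ (λ i → ⟦hasType⟧-cong (bottom i) (joinRows-↑ʳ α₁ α₂ i) (begin
        prefixSum (v ∘ (_↑ˡ q)) p ℤ.+ prefixSum (v ∘ (p ↑ʳ_)) (toℕ i)
          ≡⟨ cong₂ ℤ._+_ (prefixSum-cong top p) (trans (prefixSum-cong bottom (toℕ i)) (prefixSum-zero (toℕ i))) ⟩
        prefixSum (λ i′ → δ₁ i′ zero) p ℤ.+ + 0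
          ≡⟨ ℤₚ.+-identityʳ _ ⟩
        prefixSum (λ i′ → δ₁ i′ zero) p ∎))))
      where
      open ≡-Reasoning
      v = blockColumn δ₁ δ₂ (inj₁ zero)
      top = blockColumn-↑ˡ δ₁ δ₂ (inj₁ zero)
      bottom = blockColumn-↑ʳ δ₁ δ₂ (inj₁ zero)

    countColumns-afterLeft : ∀ xs →
      countColumns (blockColumn δ₁ δ₂) (λ r → joinRows α₁ α₂ r ℤ.+ blockColumn δ₁ δ₂ (inj₁ zero) r)
        (map (Sum.map₁ suc) xs) ≡
      countColumns (blockColumn (shiftCols δ₁) δ₂) (joinRows (advance α₁ δ₁) α₂) xs
    countColumns-afterLeft xs = trans (countColumns-map (blockColumn δ₁ δ₂) (Sum.map₁ suc) _ xs)
      (countColumns-cong (λ x r → blockDiag-map₁ δ₁ δ₂ α₁ α₂ (splitAt p r) x)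
                           (λ r → join-advance₁ δ₁ δ₂ α₁ α₂ (splitAt p r)) xs)

  module _ {p q m n} (δ₁ : Fin p → Fin m → ℤ) (δ₂ : Fin q → Fin (suc n) → ℤ) (α₁ : Fin p → ℤ) (α₂ : Fin q → ℤ) where

    sum-rightColumn :
      sum (λ r → ⟦ hasType s (blockColumn δ₁ δ₂ (inj₂ zero) r) (joinRows α₁ α₂ r)
                          (prefixSum (blockColumn δ₁ δ₂ (inj₂ zero)) (toℕ r)) ⟧) ≡
      sum (λ i → ⟦ hasType s (+ 0) (α₁ i) (+ 0) ⟧) ℕ.+
      sum (λ i → ⟦ hasType s (δ₂ i zero) (α₂ i) (prefixSum (λ i′ → δ₂ i′ zero) (toℕ i)) ⟧)
    sum-rightColumn = trans (sum-rows-↑ p v (joinRows α₁ α₂)) (cong₂ ℕ._+_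
      (sum-cong-≗ (λ i → ⟦hasType⟧-cong (top i) (joinRows-↑ˡ α₁ α₂ i)
        (trans (prefixSum-cong top (toℕ i)) (prefixSum-zero (toℕ i)))))
      (sum-cong-≗ (λ i → ⟦hasType⟧-cong (bottom i) (joinRows-↑ʳ α₁ α₂ i) (begin
        prefixSum (v ∘ (_↑ˡ q)) p ℤ.+ prefixSum (v ∘ (p ↑ʳ_)) (toℕ i)
          ≡⟨ cong₂ ℤ._+_ (trans (prefixSum-cong top p) (prefixSum-zero p)) (prefixSum-cong bottom (toℕ i)) ⟩
        + 0 ℤ.+ prefixSum (λ i′ → δ₂ i′ zero) (toℕ i)
          ≡⟨ ℤₚ.+-identityˡ _ ⟩
        prefixSum (λ i′ → δ₂ i′ zero) (toℕ i) ∎))))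
      where
      open ≡-Reasoning
      v = blockColumn δ₁ δ₂ (inj₂ zero)
      top = blockColumn-↑ˡ δ₁ δ₂ (inj₂ zero)
      bottom = blockColumn-↑ʳ δ₁ δ₂ (inj₂ zero)

    countColumns-afterRight : ∀ xs →
      countColumns (blockColumn δ₁ δ₂) (λ r → joinRows α₁ α₂ r ℤ.+ blockColumn δ₁ δ₂ (inj₂ zero) r)
        (map (Sum.map₂ suc) xs) ≡
      countColumns (blockColumn δ₁ (shiftCols δ₂)) (joinRows α₁ (advance α₂ δ₂)) xs
    countColumns-afterRight xs = trans (countColumns-map (blockColumn δ₁ δ₂) (Sum.map₂ suc) _ xs)
      (countColumns-cong (λ x r → blockDiag-map₂ δ₁ δ₂ α₁ α₂ (splitAt p r) x)
                           (λ r → join-advance₂ δ₁ δ₂ α₁ α₂ (splitAt p r)) xs)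

  -- The entries of the two zero blocks, column by column: below a column of δ₁ their
  -- b-value is that column's full sum, above a column of δ₂ it is 0.
  crossTerm : ∀ {p q m n} → Shuffle m n → (Fin p → Fin m → ℤ) → (Fin q → Fin n → ℤ) →
              (Fin p → ℤ) → (Fin q → ℤ) → ℕ
  crossTerm done δ₁ δ₂ α₁ α₂ = 0
  crossTerm {p} (takeL σ) δ₁ δ₂ α₁ α₂ =
    sum (λ i → ⟦ hasType s (+ 0) (α₂ i) (prefixSum (λ i′ → δ₁ i′ zero) p) ⟧) ℕ.+
    crossTerm σ (shiftCols δ₁) δ₂ (advance α₁ δ₁) α₂
  crossTerm (takeR σ) δ₁ δ₂ α₁ α₂ =
    sum (λ i → ⟦ hasType s (+ 0) (α₁ i) (+ 0) ⟧) ℕ.+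
    crossTerm σ δ₁ (shiftCols δ₂) α₁ (advance α₂ δ₂)

  countColumns-shuffle : ∀ {p q m n} (σ : Shuffle m n) (δ₁ : Fin p → Fin m → ℤ) (δ₂ : Fin q → Fin n → ℤ) α₁ α₂ →
    countColumns (blockColumn δ₁ δ₂) (joinRows α₁ α₂) (columnSources σ) ≡
    (countColumns (δ₁ ᵀ) α₁ (allFin m) ℕ.+ countColumns (δ₂ ᵀ) α₂ (allFin n)) ℕ.+ crossTerm σ δ₁ δ₂ α₁ α₂
  countColumns-shuffle done δ₁ δ₂ α₁ α₂ = refl
  countColumns-shuffle {p} {m = suc m} {n} (takeL σ) δ₁ δ₂ α₁ α₂ = begin
    countColumns (blockColumn δ₁ δ₂) (joinRows α₁ α₂) (columnSources (takeL σ))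
      ≡⟨ cong (countColumns (blockColumn δ₁ δ₂) (joinRows α₁ α₂)) (columnSources-takeL σ) ⟩
    countColumns (blockColumn δ₁ δ₂) (joinRows α₁ α₂) (inj₁ zero ∷ map (Sum.map₁ suc) (columnSources σ))
      ≡⟨ cong₂ ℕ._+_ (sum-leftColumn δ₁ δ₂ α₁ α₂) (countColumns-afterLeft δ₁ δ₂ α₁ α₂ (columnSources σ)) ⟩
    (diagonal ℕ.+ cross) ℕ.+
    countColumns (blockColumn (shiftCols δ₁) δ₂) (joinRows (advance α₁ δ₁) α₂) (columnSources σ)
      ≡⟨ cong ((diagonal ℕ.+ cross) ℕ.+_) (countColumns-shuffle σ (shiftCols δ₁) δ₂ (advance α₁ δ₁) α₂) ⟩
    (diagonal ℕ.+ cross) ℕ.+ ((C₁ ℕ.+ C₂) ℕ.+ X)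
      ≡⟨ regroup diagonal cross C₁ C₂ X ⟩
    ((diagonal ℕ.+ C₁) ℕ.+ C₂) ℕ.+ (cross ℕ.+ X)
      ≡⟨ cong (λ c → (c ℕ.+ C₂) ℕ.+ (cross ℕ.+ X)) (countColumns-ᵀ-suc δ₁ α₁) ⟨
    (countColumns (δ₁ ᵀ) α₁ (allFin (suc m)) ℕ.+ C₂) ℕ.+ (cross ℕ.+ X) ∎
    where
    open ≡-Reasoning
    diagonal = sum (λ i → ⟦ hasType s (δ₁ i zero) (α₁ i) (prefixSum (λ i′ → δ₁ i′ zero) (toℕ i)) ⟧)
    cross = sum (λ i → ⟦ hasType s (+ 0) (α₂ i) (prefixSum (λ i′ → δ₁ i′ zero) p) ⟧)
    C₁ = countColumns (shiftCols δ₁ ᵀ) (advance α₁ δ₁) (allFin m)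
    C₂ = countColumns (δ₂ ᵀ) α₂ (allFin n)
    X = crossTerm σ (shiftCols δ₁) δ₂ (advance α₁ δ₁) α₂
    regroup : ∀ a b c d e → (a ℕ.+ b) ℕ.+ ((c ℕ.+ d) ℕ.+ e) ≡ ((a ℕ.+ c) ℕ.+ d) ℕ.+ (b ℕ.+ e)
    regroup = solve-∀
  countColumns-shuffle {p} {m = m} {suc n} (takeR σ) δ₁ δ₂ α₁ α₂ = begin
    countColumns (blockColumn δ₁ δ₂) (joinRows α₁ α₂) (columnSources (takeR σ))
      ≡⟨ cong (countColumns (blockColumn δ₁ δ₂) (joinRows α₁ α₂)) (columnSources-takeR σ) ⟩
    countColumns (blockColumn δ₁ δ₂) (joinRows α₁ α₂) (inj₂ zero ∷ map (Sum.map₂ suc) (columnSources σ))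
      ≡⟨ cong₂ ℕ._+_ (sum-rightColumn δ₁ δ₂ α₁ α₂) (countColumns-afterRight δ₁ δ₂ α₁ α₂ (columnSources σ)) ⟩
    (cross ℕ.+ diagonal) ℕ.+
    countColumns (blockColumn δ₁ (shiftCols δ₂)) (joinRows α₁ (advance α₂ δ₂)) (columnSources σ)
      ≡⟨ cong ((cross ℕ.+ diagonal) ℕ.+_) (countColumns-shuffle σ δ₁ (shiftCols δ₂) α₁ (advance α₂ δ₂)) ⟩
    (cross ℕ.+ diagonal) ℕ.+ ((C₁ ℕ.+ C₂) ℕ.+ X)
      ≡⟨ regroup cross diagonal C₁ C₂ X ⟩
    (C₁ ℕ.+ (diagonal ℕ.+ C₂)) ℕ.+ (cross ℕ.+ X)
      ≡⟨ cong (λ c → (C₁ ℕ.+ c) ℕ.+ (cross ℕ.+ X)) (countColumns-ᵀ-suc δ₂ α₂) ⟨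
    (C₁ ℕ.+ countColumns (δ₂ ᵀ) α₂ (allFin (suc n))) ℕ.+ (cross ℕ.+ X) ∎
    where
    open ≡-Reasoning
    diagonal = sum (λ i → ⟦ hasType s (δ₂ i zero) (α₂ i) (prefixSum (λ i′ → δ₂ i′ zero) (toℕ i)) ⟧)
    cross = sum (λ i → ⟦ hasType s (+ 0) (α₁ i) (+ 0) ⟧)
    C₁ = countColumns (δ₁ ᵀ) α₁ (allFin m)
    C₂ = countColumns (shiftCols δ₂ ᵀ) (advance α₂ δ₂) (allFin n)
    X = crossTerm σ δ₁ (shiftCols δ₂) α₁ (advance α₂ δ₂)
    regroup : ∀ a b c d e → (a ℕ.+ b) ℕ.+ ((c ℕ.+ d) ℕ.+ e) ≡ (c ℕ.+ (b ℕ.+ d)) ℕ.+ (a ℕ.+ e)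
    regroup = solve-∀

-- Partial row sums in alternating sign matrices

Bit : ℤ → Set
Bit x = (x ≡ + 0) ⊎ (x ≡ + 1)

isOne isZero : ℤ → ℕ
isOne y  = ⟦ ⌊ y ℤ.≟ + 1 ⌋ ⟧
isZero y = ⟦ ⌊ y ℤ.≟ + 0 ⌋ ⟧

prefixSum-bits : ∀ {N} (α : Fin N → ℤ) → (∀ i → Bit (α i)) → prefixSum α N ≡ + sum (isOne ∘ α)
prefixSum-bits {zero}  α bits = refl
prefixSum-bits {suc N} α bits =
  trans (cong (ℤ._+_ (α zero)) (prefixSum-bits (α ∘ suc) (bits ∘ suc))) (bit-+ (bits zero))
  where
  bit-+ : ∀ {y k} → Bit y → y ℤ.+ + k ≡ + (isOne y ℕ.+ k)
  bit-+ (inj₁ refl) = refl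
  bit-+ (inj₂ refl) = refl

zeros+ones : ∀ {N} (α : Fin N → ℤ) → (∀ i → Bit (α i)) → sum (isZero ∘ α) ℕ.+ sum (isOne ∘ α) ≡ N
zeros+ones {zero}  α bits = refl
zeros+ones {suc N} α bits = begin
  (isZero (α zero) ℕ.+ sum (isZero ∘ α ∘ suc)) ℕ.+ (isOne (α zero) ℕ.+ sum (isOne ∘ α ∘ suc))
    ≡⟨ ℕ+.interchange (isZero (α zero)) _ _ _ ⟩
  (isZero (α zero) ℕ.+ isOne (α zero)) ℕ.+ (sum (isZero ∘ α ∘ suc) ℕ.+ sum (isOne ∘ α ∘ suc))
    ≡⟨ cong₂ ℕ._+_ (bit-count (bits zero)) (zeros+ones (α ∘ suc) (bits ∘ suc)) ⟩
  suc N ∎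
  where
  open ≡-Reasoning
  bit-count : ∀ {y} → Bit y → isZero y ℕ.+ isOne y ≡ 1
  bit-count (inj₁ refl) = refl
  bit-count (inj₂ refl) = refl

-- What the cross term needs to know about the last m columns δ of a p × p alternating sign
-- matrix, when α holds the row sums of its first K columns.
record IsASMSuffix {p m} (δ : Fin p → Fin m → ℤ) (α : Fin p → ℤ) (K : ℕ) : Set where
  field
    columnSum : ∀ j → prefixSum (λ i → δ i j) p ≡ + 1
    rowBits   : ∀ i k → Bit (α i ℤ.+ prefixSum (δ i) k)
    total     : prefixSum α p ≡ + K
    size      : K ℕ.+ m ≡ p

  bits : ∀ i → Bit (α i)
  bits i = subst Bit (ℤₚ.+-identityʳ (α i)) (rowBits i 0)

  ones : sum (isOne ∘ α) ≡ K
  ones = ℤₚ.+-injective (trans (sym (prefixSum-bits α bits)) total)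

  zeros : sum (isZero ∘ α) ≡ m
  zeros = ℕₚ.+-cancelˡ-≡ K _ _ (begin
    K ℕ.+ sum (isZero ∘ α)                   ≡⟨ ℕₚ.+-comm K _ ⟩
    sum (isZero ∘ α) ℕ.+ K                   ≡⟨ cong (sum (isZero ∘ α) ℕ.+_) ones ⟨
    sum (isZero ∘ α) ℕ.+ sum (isOne ∘ α)     ≡⟨ zeros+ones α bits ⟩
    p                                        ≡⟨ size ⟨
    K ℕ.+ m                                  ∎)
    where open ≡-Reasoning

isASMSuffix-shiftCols : ∀ {p m} {δ : Fin p → Fin (suc m) → ℤ} {α K} →
  IsASMSuffix δ α K → IsASMSuffix (shiftCols δ) (advance α δ) (suc K)
isASMSuffix-shiftCols {p} {m} {δ} {α} {K} suffix = record
  { columnSum = columnSum ∘ suc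
  ; rowBits   = λ i k → subst Bit (sym (ℤₚ.+-assoc (α i) (δ i zero) _)) (rowBits i (suc k))
  ; total     = begin
      prefixSum (advance α δ) p                         ≡⟨ prefixSum-+ α (λ i → δ i zero) p ⟩
      prefixSum α p ℤ.+ prefixSum (λ i → δ i zero) p   ≡⟨ cong₂ ℤ._+_ total (columnSum zero) ⟩
      + (K ℕ.+ 1)                                       ≡⟨ cong +_ (ℕₚ.+-comm K 1) ⟩
      + suc K                                           ∎
  ; size      = trans (sym (ℕₚ.+-suc K m)) size
  }
  where
  open IsASMSuffix suffix
  open ≡-Reasoning

sumℤ-nonzeros : ∀ xs → sumℤ (nonzeros xs) ≡ sumℤ xs
sumℤ-nonzeros []       = refl
sumℤ-nonzeros (x ∷ xs) with x ℤ.≟ + 0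
... | yes refl = trans (sumℤ-nonzeros xs) (sym (ℤₚ.+-identityˡ _))
... | no  _    = cong (ℤ._+_ x) (sumℤ-nonzeros xs)

take-nonzeros : ∀ xs k → ∃ λ k′ → sumℤ (take k xs) ≡ sumℤ (take k′ (nonzeros xs))
take-nonzeros xs       zero    = 0 , refl
take-nonzeros []       (suc k) = 0 , refl
take-nonzeros (x ∷ xs) (suc k) with x ℤ.≟ + 0 | take-nonzeros xs k
... | yes refl | k′ , eq = k′ , trans (ℤₚ.+-identityˡ _) eq
... | no  _    | k′ , eq = suc k′ , cong (ℤ._+_ x) eq

sumℤ-alternating : ∀ {xs} → Alternating xs → sumℤ xs ≡ + 1
sumℤ-alternating single   = refl
sumℤ-alternating (step a) = cong (λ t → + 1 ℤ.+ (-[1+ 0 ] ℤ.+ t)) (sumℤ-alternating a)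

take-alternating : ∀ {xs} → Alternating xs → ∀ k → Bit (sumℤ (take k xs))
take-alternating a                     zero          = inj₁ refl
take-alternating single                (suc zero)    = inj₂ refl
take-alternating single                (suc (suc k)) = inj₂ refl
take-alternating (step a)              (suc zero)    = inj₂ refl
take-alternating {_ ∷ _ ∷ xs} (step a) (suc (suc k)) =
  subst Bit (sym (trans (sym (ℤₚ.+-assoc (+ 1) -[1+ 0 ] t)) (ℤₚ.+-identityˡ t))) (take-alternating a k)
  where t = sumℤ (take k xs)

take-bit : ∀ xs → Alternating (nonzeros xs) → ∀ k → Bit (sumℤ (take k xs))
take-bit xs a k with take-nonzeros xs k
... | k′ , eq = subst Bit (sym eq) (take-alternating a k′)

IsASM⇒IsASMSuffix : ∀ {m} {δ : Mat m} → IsASM δ → IsASMSuffix δ (λ _ → + 0) 0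
IsASM⇒IsASMSuffix {m} {δ} asm = record
  { columnSum = λ j → begin
      prefixSum (λ i → δ i j) m          ≡⟨ prefixSum-all (λ i → δ i j) ⟩
      sumℤ (tabulate (λ i → δ i j))      ≡⟨ cong sumℤ (map-allFin (λ i → δ i j)) ⟨
      sumℤ (col δ j)                     ≡⟨ sumℤ-nonzeros (col δ j) ⟨
      sumℤ (nonzeros (col δ j))          ≡⟨ sumℤ-alternating (cols j) ⟩
      + 1                                ∎
  ; rowBits   = λ i k → subst Bit
      (trans (cong (sumℤ ∘ take k) (map-allFin (δ i))) (sym (ℤₚ.+-identityˡ _)))
      (take-bit (row δ i) (rows i) k)
  ; total     = prefixSum-zero m
  ; size      = refl
  }
  where
  open IsASM asm
  open ≡-Reasoning

-- The entries of type s in a zero segment of a column, with b-value 1 (below) or 0 (beside),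
-- when the a-values consist of `ones` ones and `zeros` zeros.
belowCount besideCount : Stat → ℕ → ℕ → ℕ
belowCount se ones zeros = zeros
belowCount sw ones zeros = ones
belowCount nw ones zeros = 0
belowCount ne ones zeros = 0
besideCount ne ones zeros = zeros
besideCount nw ones zeros = ones
besideCount se ones zeros = 0
besideCount sw ones zeros = 0

hasType-below : ∀ s {y} → Bit y → ⟦ hasType s (+ 0) y (+ 1) ⟧ ≡ belowCount s (isOne y) (isZero y)
hasType-below se (inj₁ refl) = refl
hasType-below se (inj₂ refl) = refl
hasType-below sw (inj₁ refl) = refl
hasType-below sw (inj₂ refl) = refl
hasType-below nw (inj₁ refl) = refl
hasType-below nw (inj₂ refl) = refl
hasType-below ne (inj₁ refl) = refl
hasType-below ne (inj₂ refl) = refl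

hasType-beside : ∀ s {y} → Bit y → ⟦ hasType s (+ 0) y (+ 0) ⟧ ≡ besideCount s (isOne y) (isZero y)
hasType-beside se (inj₁ refl) = refl
hasType-beside se (inj₂ refl) = refl
hasType-beside sw (inj₁ refl) = refl
hasType-beside sw (inj₂ refl) = refl
hasType-beside nw (inj₁ refl) = refl
hasType-beside nw (inj₂ refl) = refl
hasType-beside ne (inj₁ refl) = refl
hasType-beside ne (inj₂ refl) = refl

sum-belowCount : ∀ s {N} (α : Fin N → ℤ) →
  sum (λ i → belowCount s (isOne (α i)) (isZero (α i))) ≡ belowCount s (sum (isOne ∘ α)) (sum (isZero ∘ α))
sum-belowCount se     α = refl
sum-belowCount sw     α = refl
sum-belowCount nw {N} α = sum-replicate-zero N
sum-belowCount ne {N} α = sum-replicate-zero N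

sum-besideCount : ∀ s {N} (α : Fin N → ℤ) →
  sum (λ i → besideCount s (isOne (α i)) (isZero (α i))) ≡ besideCount s (sum (isOne ∘ α)) (sum (isZero ∘ α))
sum-besideCount ne     α = refl
sum-besideCount nw     α = refl
sum-besideCount se {N} α = sum-replicate-zero N
sum-besideCount sw {N} α = sum-replicate-zero N

module _ {p m} {δ : Fin p → Fin m → ℤ} {α K} (suffix : IsASMSuffix δ α K) (s : Stat) where
  open IsASMSuffix suffix

  sum-hasType-below : sum (λ i → ⟦ hasType s (+ 0) (α i) (+ 1) ⟧) ≡ belowCount s K m
  sum-hasType-below = trans (sum-cong-≗ (hasType-below s ∘ bits))
    (trans (sum-belowCount s α) (cong₂ (belowCount s) ones zeros))

  sum-hasType-beside : sum (λ i → ⟦ hasType s (+ 0) (α i) (+ 0) ⟧) ≡ besideCount s K m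
  sum-hasType-beside = trans (sum-cong-≗ (hasType-beside s ∘ bits))
    (trans (sum-besideCount s α) (cong₂ (besideCount s) ones zeros))

-- K₁ and K₂ are the numbers of left and right columns placed before σ.
crossingsFrom : Stat → ∀ {m n} → Shuffle m n → ℕ → ℕ → ℕ
crossingsFrom s done              K₁ K₂ = 0
crossingsFrom s (takeL {m} {n} σ) K₁ K₂ = belowCount s K₂ n ℕ.+ crossingsFrom s σ (suc K₁) K₂
crossingsFrom s (takeR {m} {n} σ) K₁ K₂ = besideCount s K₁ m ℕ.+ crossingsFrom s σ K₁ (suc K₂)

crossings : Stat → ∀ {m n} → Shuffle m n → ℕ
crossings se = pairsLR
crossings nw = pairsLR
crossings ne = pairsRL
crossings sw = pairsRL

crossingsFrom-se : ∀ {m n} (σ : Shuffle m n) K₁ K₂ → crossingsFrom se σ K₁ K₂ ≡ pairsLR σ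
crossingsFrom-se done      K₁ K₂ = refl
crossingsFrom-se (takeL σ) K₁ K₂ = cong (_ ℕ.+_) (crossingsFrom-se σ (suc K₁) K₂)
crossingsFrom-se (takeR σ) K₁ K₂ = crossingsFrom-se σ K₁ (suc K₂)

crossingsFrom-ne : ∀ {m n} (σ : Shuffle m n) K₁ K₂ → crossingsFrom ne σ K₁ K₂ ≡ pairsRL σ
crossingsFrom-ne done      K₁ K₂ = refl
crossingsFrom-ne (takeL σ) K₁ K₂ = crossingsFrom-ne σ (suc K₁) K₂
crossingsFrom-ne (takeR σ) K₁ K₂ = cong (_ ℕ.+_) (crossingsFrom-ne σ K₁ (suc K₂))

crossingsFrom-nw : ∀ {m n} (σ : Shuffle m n) K₁ K₂ → crossingsFrom nw σ K₁ K₂ ≡ K₁ ℕ.* n ℕ.+ pairsLR σ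
crossingsFrom-nw done K₁ K₂ = sym (trans (ℕₚ.+-identityʳ _) (ℕₚ.*-zeroʳ K₁))
crossingsFrom-nw (takeL {m} {n} σ) K₁ K₂ =
  trans (crossingsFrom-nw σ (suc K₁) K₂) (arith K₁ n (pairsLR σ))
  where
  arith : ∀ a b c → suc a ℕ.* b ℕ.+ c ≡ a ℕ.* b ℕ.+ (b ℕ.+ c)
  arith = solve-∀
crossingsFrom-nw (takeR {m} {n} σ) K₁ K₂ =
  trans (cong (K₁ ℕ.+_) (crossingsFrom-nw σ K₁ (suc K₂))) (arith K₁ n (pairsLR σ))
  where
  arith : ∀ a b c → a ℕ.+ (a ℕ.* b ℕ.+ c) ≡ a ℕ.* suc b ℕ.+ c
  arith = solve-∀

crossingsFrom-sw : ∀ {m n} (σ : Shuffle m n) K₁ K₂ → crossingsFrom sw σ K₁ K₂ ≡ K₂ ℕ.* m ℕ.+ pairsRL σ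
crossingsFrom-sw done K₁ K₂ = sym (trans (ℕₚ.+-identityʳ _) (ℕₚ.*-zeroʳ K₂))
crossingsFrom-sw (takeL {m} {n} σ) K₁ K₂ =
  trans (cong (K₂ ℕ.+_) (crossingsFrom-sw σ (suc K₁) K₂)) (arith K₂ m (pairsRL σ))
  where
  arith : ∀ a b c → a ℕ.+ (a ℕ.* b ℕ.+ c) ≡ a ℕ.* suc b ℕ.+ c
  arith = solve-∀
crossingsFrom-sw (takeR {m} {n} σ) K₁ K₂ =
  trans (crossingsFrom-sw σ K₁ (suc K₂)) (arith K₂ m (pairsRL σ))
  where
  arith : ∀ a b c → suc a ℕ.* b ℕ.+ c ≡ a ℕ.* b ℕ.+ (b ℕ.+ c)
  arith = solve-∀

crossingsFrom-zero : ∀ s {m n} (σ : Shuffle m n) → crossingsFrom s σ 0 0 ≡ crossings s σ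
crossingsFrom-zero se σ = crossingsFrom-se σ 0 0
crossingsFrom-zero nw σ = crossingsFrom-nw σ 0 0
crossingsFrom-zero ne σ = crossingsFrom-ne σ 0 0
crossingsFrom-zero sw σ = crossingsFrom-sw σ 0 0

crossTerm≡crossingsFrom : ∀ s {p q m n} (σ : Shuffle m n) {δ₁ : Fin p → Fin m → ℤ} {δ₂ : Fin q → Fin n → ℤ}
  {α₁ α₂ K₁ K₂} → IsASMSuffix δ₁ α₁ K₁ → IsASMSuffix δ₂ α₂ K₂ →
  crossTerm s σ δ₁ δ₂ α₁ α₂ ≡ crossingsFrom s σ K₁ K₂
crossTerm≡crossingsFrom s done _ _ = refl
crossTerm≡crossingsFrom s (takeL σ) {α₂ = α₂} suffix₁ suffix₂ = cong₂ ℕ._+_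
  (trans (sum-cong-≗ (λ i → cong (λ b → ⟦ hasType s (+ 0) (α₂ i) b ⟧) (IsASMSuffix.columnSum suffix₁ zero)))
         (sum-hasType-below suffix₂ s))
  (crossTerm≡crossingsFrom s σ (isASMSuffix-shiftCols suffix₁) suffix₂)
crossTerm≡crossingsFrom s (takeR σ) suffix₁ suffix₂ = cong₂ ℕ._+_
  (sum-hasType-beside suffix₁ s)
  (crossTerm≡crossingsFrom s σ suffix₁ (isASMSuffix-shiftCols suffix₂))

joinRows-zero : ∀ {p q} r → joinRows {p} {q} (λ _ → + 0) (λ _ → + 0) r ≡ + 0
joinRows-zero {p} r with splitAt p r
... | inj₁ _ = refl
... | inj₂ _ = refl

stat-shuffleMat : ∀ s {m n} {δ₁ : Mat m} {δ₂ : Mat n} → IsASM δ₁ → IsASM δ₂ → ∀ σ →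
  stat s (shuffleMat σ δ₁ δ₂) ≡ (stat s δ₁ ℕ.+ stat s δ₂) ℕ.+ crossings s σ
stat-shuffleMat s {m} {n} {δ₁} {δ₂} asm₁ asm₂ σ = begin
  stat s (shuffleMat σ δ₁ δ₂)
    ≡⟨ stat≡countColumns s (shuffleMat σ δ₁ δ₂) ⟩
  countColumns s (shuffleMat σ δ₁ δ₂ ᵀ) (λ _ → + 0) (allFin (m ℕ.+ n))
    ≡⟨ countColumns-cong s (λ c r → shuffleMat≡blockColumn σ δ₁ δ₂ r c) (λ r → sym (joinRows-zero {m} {n} r))
                         (allFin (m ℕ.+ n)) ⟩
  countColumns s (blockColumn δ₁ δ₂ ∘ colSource σ) zeros (allFin (m ℕ.+ n))
    ≡⟨ countColumns-map s (blockColumn δ₁ δ₂) (colSource σ) zeros (allFin (m ℕ.+ n)) ⟨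
  countColumns s (blockColumn δ₁ δ₂) zeros (map (colSource σ) (allFin (m ℕ.+ n)))
    ≡⟨ cong (countColumns s (blockColumn δ₁ δ₂) zeros) (map-allFin (colSource σ)) ⟩
  countColumns s (blockColumn δ₁ δ₂) zeros (columnSources σ)
    ≡⟨ countColumns-shuffle s σ δ₁ δ₂ (λ _ → + 0) (λ _ → + 0) ⟩
  (countColumns s (δ₁ ᵀ) (λ _ → + 0) (allFin m) ℕ.+ countColumns s (δ₂ ᵀ) (λ _ → + 0) (allFin n)) ℕ.+
  crossTerm s σ δ₁ δ₂ (λ _ → + 0) (λ _ → + 0)
    ≡⟨ cong₂ ℕ._+_ (cong₂ ℕ._+_ (stat≡countColumns s δ₁) (stat≡countColumns s δ₂)) cross ⟨
  (stat s δ₁ ℕ.+ stat s δ₂) ℕ.+ crossings s σ ∎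
  where
  open ≡-Reasoning
  zeros = joinRows {m} {n} (λ _ → + 0) (λ _ → + 0)
  cross : crossings s σ ≡ crossTerm s σ δ₁ δ₂ (λ _ → + 0) (λ _ → + 0)
  cross = sym (trans (crossTerm≡crossingsFrom s σ (IsASM⇒IsASMSuffix asm₁) (IsASM⇒IsASMSuffix asm₂))
                     (crossingsFrom-zero s σ))

shuffleGF-crossings : ∀ s m n → (shuffleGF (crossings s) m n ⊗ (qFact m ⊗ qFact n)) ≋ qFact (m ℕ.+ n)
shuffleGF-crossings se = shuffleGF-pairsLR
shuffleGF-crossings nw = shuffleGF-pairsLR
shuffleGF-crossings ne = shuffleGF-pairsRL
shuffleGF-crossings sw = shuffleGF-pairsRL

φProd-≃ : ∀ s {m n} {δ₁ : Mat m} {δ₂ : Mat n} → IsASM δ₁ → IsASM δ₂ → φProd s δ₁ δ₂ ≃ (φ s δ₁ *ᵣ φ s δ₂)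
φProd-≃ s {m} {n} {δ₁} {δ₂} asm₁ asm₂ =
  sumᵣ-fractions-≃ term (qFact (m ℕ.+ n)) shuffles (allShuffles≢[] m n) (φ s δ₁ *ᵣ φ s δ₂) (coeff-≡ (begin
    Σₚ (map term shuffles) ⊗ E
      ≈⟨ ⊗-congˡ E (Σₚ-map-cong (λ σ → ≡⇒≋ (cong qPow (stat-shuffleMat s asm₁ asm₂ σ))) shuffles) ⟩
    Σₚ (map (λ σ → qPow ((a ℕ.+ b) ℕ.+ crossings s σ)) shuffles) ⊗ E
      ≈⟨ ⊗-congˡ E (Σₚ-qPow-+ (a ℕ.+ b) (λ σ → crossings s σ) shuffles) ⟩
    (qPow (a ℕ.+ b) ⊗ shuffleGF (crossings s) m n) ⊗ E
      ≈⟨ ⊗-assoc (qPow (a ℕ.+ b)) (shuffleGF (crossings s) m n) E ⟩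
    qPow (a ℕ.+ b) ⊗ (shuffleGF (crossings s) m n ⊗ E)
      ≈⟨ ⊗-cong (qPow-+ a b) (shuffleGF-crossings s m n) ⟩
    (qPow a ⊗ qPow b) ⊗ qFact (m ℕ.+ n) ∎))
  where
  open ≋-Reasoning
  term : Shuffle m n → Poly
  term σ = qPow (stat s (shuffleMat σ δ₁ δ₂))
  shuffles = allShuffles m n
  a = stat s δ₁
  b = stat s δ₂
  E = qFact m ⊗ qFact n

proposition4p4 : (s : Stat) →
    (φ s emptyMat ≃ 1ᵣ) ×
    (∀ (m n : ℕ) (δ₁ : Mat m) (δ₂ : Mat n) → IsASM δ₁ → IsASM δ₂ →
      φProd s δ₁ δ₂ ≃ (φ s δ₁ *ᵣ φ s δ₂))
proposition4p4 s = (λ _ → refl) , (λ m n δ₁ δ₂ → φProd-≃ s)
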